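{- Let $p>5$ be a prime with $p\equiv 1\pmod 4$. Then the cyclic group $\mathbb Z_{4p}$, the Frobenius group $F_{4p}=\mathbb Z_p\rtimes\mathbb Z_4$ of order $4p$, and the dicyclic group of order $4p$ are not CI-groups with respect to ternary relational structures.
   Context: The Frobenius group $F_{4p}$ is $\mathbb Z_p\rtimes\mathbb Z_4$ with $\mathbb Z_4$ acting faithfully (by multiplication by an element of order $4$ in $\mathbb Z_p^*$); the dicyclic group of order $4p$ is $\mathbb Z_p\rtimes\mathbb Z_4$ with the generator of $\mathbb Z_4$ acting by inversion. A ternary relational structure on a set $V$ is a collection of subsets of $V^3$; isomorphisms are bijections mapping the collection of relations of one onto that of the other; it is a Cayley object of a group $G$ if its automorphism group contains the left regular representation of $G$. $G$ is a CI-group with respect to ternary relational structures if any two isomorphic Cayley ternary relational structures on $G$ are isomorphic via a group automorphism of $G$. -}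

module Defs where

open import Data.Nat using (ℕ; zero; suc; _+_; _*_; _^_)
open import Data.Nat.DivMod using (_%_; m%n<n)
open import Data.Fin using (Fin; toℕ; fromℕ<)
open import Data.Bool using (Bool)
open import Data.List using (List)
open import Data.List.Membership.Propositional using (_∈_)
open import Data.Product using (_×_; _,_; ∃)
open import Relation.Binary.PropositionalEquality using (_≡_)
open import Function.Definitions using (Bijective)

-- reduce m modulo n, as an element of Fin n (Fin n is inhabited by the
-- first argument, so n ≠ 0)
reduce : ∀ {n} → Fin n → ℕ → Fin n
reduce {suc n} _ m = fromℕ< (m%n<n m (suc n))

addMod : ∀ {n} → Fin n → Fin n → Fin n
addMod a b = reduce a (toℕ a + toℕ b)

-- The semidirect product ℤ_p ⋊ ℤ_4 where the generator 1 ∈ ℤ_4 acts on ℤ_p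
-- by multiplication by r :  (a , b) · (c , d) = (a + r^b c , b + d).
sdOp : ∀ {p} → ℕ → (Fin p × Fin 4) → (Fin p × Fin 4) → (Fin p × Fin 4)
sdOp r (a , b) (c , d) = reduce a (toℕ a + r ^ toℕ b * toℕ c) , addMod b d

Rel3 : Set → Set
Rel3 V = V → V → V → Bool

TRS : Set → Set
TRS V = List (Rel3 V)

MapsTo : ∀ {V W : Set} → (V → W) → Rel3 V → Rel3 W → Set
MapsTo f R R' = ∀ x y z → R x y z ≡ R' (f x) (f y) (f z)

IsIso : ∀ {V W : Set} → (V → W) → TRS V → TRS W → Set
IsIso f X Y =
  Bijective _≡_ _≡_ f
  × (∀ R → R ∈ X → ∃ λ R' → R' ∈ Y × MapsTo f R R')
  × (∀ R' → R' ∈ Y → ∃ λ R → R ∈ X × MapsTo f R R')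

IsCayley : ∀ {G : Set} → (G → G → G) → TRS G → Set
IsCayley _·_ X = ∀ g → IsIso (g ·_) X X

IsGroupAut : ∀ {G : Set} → (G → G → G) → (G → G) → Set
IsGroupAut _·_ α = Bijective _≡_ _≡_ α × (∀ x y → α (x · y) ≡ (α x · α y))

IsCI3 : (G : Set) → (G → G → G) → Set
IsCI3 G _·_ =
  ∀ (X Y : TRS G) → IsCayley _·_ X → IsCayley _·_ Y →
  (∃ λ f → IsIso f X Y) →
  ∃ λ α → IsGroupAut _·_ α × IsIso α X Y

module Submission where

-- Each of the three groups is ℤₚ ⋊ ℤ₄ with the generator of ℤ₄ acting by some ρ with ρ⁴ ≡ 1
-- (mod p): ρ = 1 for ℤ₄ₚ ≅ ℤₚ × ℤ₄, ρ = r with r² ≡ −1 for the Frobenius group and ρ = −1 for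
-- the dicyclic group.  Since p ≡ 1 (mod 4), −1 is a square modulo p: otherwise x ↦ ±x⁻¹,
-- normalised into [2, (p − 1)/2], would be a fixed-point-free involution of a set of odd size
-- (p − 3)/2.
-- Fix r with r² ≡ −1, the equation E : 2y + rz ≡ (1 + r)x + z, and its twist E′ obtained by
-- multiplying the coefficients of y and z by r and r².  Let R_E be the ternary relation of the
-- triples whose ℤ₄-parts are b, b + 1, b + 2 and whose ℤₚ-parts solve E.  Both sides of E, and
-- of E′ (because r² ≡ −1), have equal coefficient sums, so R_E and R_E′ are invariant under left
-- translations, and (a, b) ↦ (rᵇa, b) maps R_E′ onto R_E.  An automorphism α doing the same
-- fixes e and maps t = (1, 0) to some (u, 0) with u ≢ 0; comparing the images of the triples
-- (e, s, s²) and (e, t¹⁺ʳs, t²s²) of R_E′, where s = (0, 1), gives 4ru ≡ 0 (mod p), which is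
-- impossible.

open import Defs
open import Data.Nat using (ℕ; _+_; _*_; _∸_; _<_)
open import Data.Nat.DivMod using (_%_)
open import Data.Nat.Divisibility using (_∣_)
open import Data.Nat.Primality using (Prime)
open import Data.Fin using (Fin)
open import Data.Product using (_×_)
open import Relation.Nullary using (¬_)
open import Relation.Binary.PropositionalEquality using (_≡_)

open import Data.Bool using (true; false; if_then_else_)
open import Data.Empty using (⊥)
open import Data.Fin using (toℕ; fromℕ<)
open import Data.Fin.Properties using (any?; toℕ<n; toℕ-fromℕ<; toℕ-injective)
open import Data.List using ([]; _∷_; map)
open import Data.List.Membership.Propositional using (_∈_)
open import Data.List.Membership.Propositional.Properties using (∈-map⁺; ∈-map⁻)
open import Data.List.Relation.Unary.Any using (here)
open import Data.Nat
open import Data.Nat.Coprimality using (prime⇒coprime; coprime-Bézout)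
open import Data.Nat.DivMod
open import Data.Nat.Divisibility
  using (divides; _∣0; ∣-refl; ∣m∣n⇒∣m+n; m%n≡0⇒n∣m; n∣m⇒m%n≡0; >⇒∤; ∣1⇒≡1; ∣m+n∣m⇒∣n; n∣m*n; m∣m*n; ∣⇒≤)
open import Data.Nat.GCD using (module Bézout)
open import Data.Nat.Primality using (euclidsLemma; prime⇒nonZero; prime⇒nonTrivial; ¬prime[1])
open import Data.Nat.Properties
open import Data.Nat.Tactic.RingSolver using (solve-∀)
open import Data.Product using (_,_; ∃; proj₁; proj₂)
import Data.Product as Product
open import Data.Product.Function.NonDependent.Propositional using (_×-⇔_)
open import Data.Sum using (_⊎_; inj₁; inj₂; [_,_]′)
open import Function using (_∘_; id)
open import Function.Bundles using (_⇔_; mk⇔; Equivalence)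
open import Function.Consequences.Propositional
  using (inverseᵇ⇒bijective; strictlyInverseˡ⇒inverseˡ; strictlyInverseʳ⇒inverseʳ; strictlySurjective⇒surjective)
import Function.Construct.Composition as Composition
open import Function.Definitions using (Injective; Bijective)
open import Function.Properties.Equivalence using (⇔-setoid)
open import Level using (0ℓ)
open import Relation.Binary.Bundles using (Setoid)
open import Relation.Binary.PropositionalEquality
open import Relation.Binary.Structures using (IsEquivalence)
import Relation.Binary.Reasoning.Setoid as SetoidReasoning
open import Relation.Nullary using (Dec; does; yes; no; ¬?; _×-dec_; contradiction)
open import Relation.Nullary.Decidable using (map′; does-⇔; dec-true; dec-false; decidable-stable)
open import Relation.Unary using (Pred; Decidable)


-- Congruences modulo m

module Congruence (m : ℕ) .{{_ : NonZero m}} where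

  infix 4 _≈_ _≈?_

  -- a record, so that a and b can be inferred from a proof of a ≈ b
  record _≈_ (a b : ℕ) : Set where
    constructor mk≈
    field %-≡ : a % m ≡ b % m
  open _≈_ public

  ≈-isEquivalence : IsEquivalence _≈_
  ≈-isEquivalence = record
    { refl  = mk≈ refl
    ; sym   = λ (mk≈ e) → mk≈ (sym e)
    ; trans = λ (mk≈ e) (mk≈ f) → mk≈ (trans e f)
    }

  ≈-setoid : Setoid 0ℓ 0ℓ
  ≈-setoid = record { isEquivalence = ≈-isEquivalence }

  open IsEquivalence ≈-isEquivalence public
    using () renaming (refl to ≈-refl; sym to ≈-sym; trans to ≈-trans; reflexive to ≈-reflexive)
  module ≈-Reasoning = SetoidReasoning ≈-setoid

  _≈?_ : ∀ a b → Dec (a ≈ b)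
  a ≈? b = map′ mk≈ %-≡ (a % m ≟ b % m)

  %-≈ : ∀ a → a % m ≈ a
  %-≈ a = mk≈ (m%n%n≡m%n a m)

  0%m≡0 : 0 % m ≡ 0
  0%m≡0 = m<n⇒m%n≡m (>-nonZero⁻¹ m)

  m≈0 : m ≈ 0
  m≈0 = mk≈ (trans (n%n≡0 m) (sym 0%m≡0))

  ≈0⇒∣ : ∀ {a} → a ≈ 0 → m ∣ a
  ≈0⇒∣ {a} (mk≈ e) = m%n≡0⇒n∣m a m (trans e 0%m≡0)

  ∣⇒≈0 : ∀ {a} → m ∣ a → a ≈ 0
  ∣⇒≈0 {a} d = mk≈ (trans (n∣m⇒m%n≡0 a m d) (sym 0%m≡0))

  ≈∧<⇒≡ : ∀ {a b} → a < m → b < m → a ≈ b → a ≡ b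
  ≈∧<⇒≡ a<m b<m (mk≈ e) = trans (sym (m<n⇒m%n≡m a<m)) (trans e (m<n⇒m%n≡m b<m))

  +-cong : ∀ {a a′ b b′} → a ≈ a′ → b ≈ b′ → a + b ≈ a′ + b′
  +-cong {a} {a′} {b} {b′} (mk≈ e₁) (mk≈ e₂) = mk≈ (begin
    (a + b) % m               ≡⟨ %-distribˡ-+ a b m ⟩
    (a % m + b % m) % m       ≡⟨ cong₂ (λ u v → (u + v) % m) e₁ e₂ ⟩
    (a′ % m + b′ % m) % m     ≡⟨ %-distribˡ-+ a′ b′ m ⟨
    (a′ + b′) % m             ∎)
    where open ≡-Reasoning

  *-cong : ∀ {a a′ b b′} → a ≈ a′ → b ≈ b′ → a * b ≈ a′ * b′
  *-cong {a} {a′} {b} {b′} (mk≈ e₁) (mk≈ e₂) = mk≈ (begin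
    (a * b) % m               ≡⟨ %-distribˡ-* a b m ⟩
    (a % m * (b % m)) % m     ≡⟨ cong₂ (λ u v → (u * v) % m) e₁ e₂ ⟩
    (a′ % m * (b′ % m)) % m   ≡⟨ %-distribˡ-* a′ b′ m ⟨
    (a′ * b′) % m             ∎)
    where open ≡-Reasoning

  +-congˡ : ∀ a {b b′} → b ≈ b′ → a + b ≈ a + b′
  +-congˡ a = +-cong (≈-refl {a})

  +-congʳ : ∀ b {a a′} → a ≈ a′ → a + b ≈ a′ + b
  +-congʳ b e = +-cong e (≈-refl {b})

  *-congˡ : ∀ a {b b′} → b ≈ b′ → a * b ≈ a * b′
  *-congˡ a = *-cong (≈-refl {a})

  *-congʳ : ∀ b {a a′} → a ≈ a′ → a * b ≈ a′ * b
  *-congʳ b e = *-cong e (≈-refl {b})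

  neg : ℕ → ℕ
  neg a = m ∸ a % m

  +-inverseʳ : ∀ a → a + neg a ≈ 0
  +-inverseʳ a = begin
    a + neg a         ≈⟨ +-congʳ (neg a) (%-≈ a) ⟨
    a % m + neg a     ≡⟨ m+[n∸m]≡n (<⇒≤ (m%n<n a m)) ⟩
    m                 ≈⟨ m≈0 ⟩
    0                 ∎
    where open ≈-Reasoning

  +-cancelˡ : ∀ a {x y} → a + x ≈ a + y → x ≈ y
  +-cancelˡ a {x} {y} e = begin
    x                       ≈⟨ +-congʳ x (+-inverseʳ a) ⟨
    (a + neg a) + x         ≡⟨ swap a (neg a) x ⟩
    neg a + (a + x)         ≈⟨ +-congˡ (neg a) e ⟩
    neg a + (a + y)         ≡⟨ swap a (neg a) y ⟨
    (a + neg a) + y         ≈⟨ +-congʳ y (+-inverseʳ a) ⟩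
    y                       ∎
    where
    open ≈-Reasoning
    swap : ∀ a b c → (a + b) + c ≡ b + (a + c)
    swap = solve-∀

  +-cancelʳ : ∀ a {x y} → x + a ≈ y + a → x ≈ y
  +-cancelʳ a {x} {y} e = +-cancelˡ a (≈-trans (≈-reflexive (+-comm a x)) (≈-trans e (≈-reflexive (+-comm y a))))

  *-cancelˡ-unit : ∀ u v {x y} → v * u ≈ 1 → u * x ≈ u * y → x ≈ y
  *-cancelˡ-unit u v {x} {y} vu≈1 e = begin
    x              ≡⟨ *-identityˡ x ⟨
    1 * x          ≈⟨ *-congʳ x vu≈1 ⟨
    v * u * x      ≡⟨ *-assoc v u x ⟩
    v * (u * x)    ≈⟨ *-congˡ v e ⟩
    v * (u * y)    ≡⟨ *-assoc v u y ⟨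
    v * u * y      ≈⟨ *-congʳ y vu≈1 ⟩
    1 * y          ≡⟨ *-identityˡ y ⟩
    y              ∎
    where open ≈-Reasoning

  inverse-unique : ∀ x {y z} → x * y ≈ 1 → x * z ≈ 1 → y ≈ z
  inverse-unique x {y} {z} xy≈1 xz≈1 =
    *-cancelˡ-unit x y (≈-trans (≈-reflexive (*-comm y x)) xy≈1) (≈-trans xy≈1 (≈-sym xz≈1))

  module _ {t d : ℕ} .{{_ : NonZero d}} (tᵈ≈1 : t ^ d ≈ 1) where

    t^[k%d]≈t^k : ∀ k → t ^ (k % d) ≈ t ^ k
    t^[k%d]≈t^k k = begin
      t ^ (k % d)                    ≡⟨ *-identityʳ (t ^ (k % d)) ⟨
      t ^ (k % d) * 1                ≈⟨ *-congˡ (t ^ (k % d)) (powers-of-one (k / d)) ⟨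
      t ^ (k % d) * (t ^ d) ^ (k / d) ≡⟨ cong (t ^ (k % d) *_) (^-*-assoc t d (k / d)) ⟩
      t ^ (k % d) * t ^ (d * (k / d)) ≡⟨ ^-distribˡ-+-* t (k % d) (d * (k / d)) ⟨
      t ^ (k % d + d * (k / d))       ≡⟨ cong (λ e → t ^ (k % d + e)) (*-comm d (k / d)) ⟩
      t ^ (k % d + k / d * d)         ≡⟨ cong (t ^_) (m≡m%n+[m/n]*n k d) ⟨
      t ^ k                           ∎
      where
      open ≈-Reasoning
      powers-of-one : ∀ j → (t ^ d) ^ j ≈ 1
      powers-of-one zero    = ≈-refl
      powers-of-one (suc j) = *-cong tᵈ≈1 (powers-of-one j)

    t^[d∸k]*t^k≈1 : ∀ k → k ≤ d → t ^ (d ∸ k) * t ^ k ≈ 1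
    t^[d∸k]*t^k≈1 k k≤d = begin
      t ^ (d ∸ k) * t ^ k   ≡⟨ ^-distribˡ-+-* t (d ∸ k) k ⟨
      t ^ (d ∸ k + k)       ≡⟨ cong (t ^_) (m∸n+n≡m k≤d) ⟩
      t ^ d                 ≈⟨ tᵈ≈1 ⟩
      1                     ∎
      where open ≈-Reasoning

  [m∸a]*[m∸b]≈a*b : ∀ {a b} → a ≤ m → b ≤ m → (m ∸ a) * (m ∸ b) ≈ a * b
  [m∸a]*[m∸b]≈a*b {a} {b} a≤m b≤m = +-cancelʳ ((m ∸ a) * b) (begin
    (m ∸ a) * (m ∸ b) + (m ∸ a) * b   ≡⟨ *-distribˡ-+ (m ∸ a) (m ∸ b) b ⟨
    (m ∸ a) * (m ∸ b + b)             ≡⟨ cong ((m ∸ a) *_) (m∸n+n≡m b≤m) ⟩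
    (m ∸ a) * m                       ≈⟨ *-congˡ (m ∸ a) m≈0 ⟩
    (m ∸ a) * 0                       ≡⟨ *-zeroʳ (m ∸ a) ⟩
    0 * b                             ≈⟨ *-congʳ b m≈0 ⟨
    m * b                             ≡⟨ cong (_* b) (m+[n∸m]≡n a≤m) ⟨
    (a + (m ∸ a)) * b                 ≡⟨ *-distribʳ-+ b a (m ∸ a) ⟩
    a * b + (m ∸ a) * b               ∎)
    where open ≈-Reasoning

  [m∸1]²≈1 : (m ∸ 1) * (m ∸ 1) ≈ 1
  [m∸1]²≈1 = [m∸a]*[m∸b]≈a*b (>-nonZero⁻¹ m) (>-nonZero⁻¹ m)

  t²≈1⇒t⁴≈1 : ∀ t → t * t ≈ 1 → t ^ 4 ≈ 1
  t²≈1⇒t⁴≈1 t t²≈1 = begin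
    t ^ 4               ≡⟨ ^-*-assoc t 2 2 ⟨
    (t ^ 2) ^ 2         ≡⟨ cong (λ s → s * (s * 1)) (cong (t *_) (*-identityʳ t)) ⟩
    t * t * (t * t * 1) ≈⟨ *-cong t²≈1 (*-congʳ 1 t²≈1) ⟩
    1                   ∎
    where open ≈-Reasoning

  t²+1≈0⇒t⁴≈1 : ∀ t → t * t + 1 ≈ 0 → t ^ 4 ≈ 1
  t²+1≈0⇒t⁴≈1 t t²+1≈0 = +-cancelʳ (t * t) (begin
    t ^ 4 + t * t       ≡⟨ factor t ⟩
    t * t * (t * t + 1) ≈⟨ *-congˡ (t * t) t²+1≈0 ⟩
    t * t * 0           ≡⟨ *-zeroʳ (t * t) ⟩
    0                   ≈⟨ t²+1≈0 ⟨
    t * t + 1           ≡⟨ +-comm (t * t) 1 ⟩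
    1 + t * t           ∎)
    where
    open ≈-Reasoning
    factor : ∀ t → t * (t * (t * (t * 1))) + t * t ≡ t * t * (t * t + 1)
    factor = solve-∀

  1≉0 : 1 < m → ¬ 1 ≈ 0
  1≉0 1<m 1≈0 with () ← ≈∧<⇒≡ 1<m (>-nonZero⁻¹ m) 1≈0

  ≈⇒∣∸ : ∀ {x y} → x ≤ y → x ≈ y → m ∣ y ∸ x
  ≈⇒∣∸ {x} {y} x≤y x≈y = ≈0⇒∣ (+-cancelˡ x (begin
    x + (y ∸ x)    ≡⟨ m+[n∸m]≡n x≤y ⟩
    y              ≈⟨ x≈y ⟨
    x              ≡⟨ +-identityʳ x ⟨
    x + 0          ∎))
    where open ≈-Reasoning


-- Counting, and fixed-point-free involutions

count : {P : Pred ℕ 0ℓ} → Decidable P → ℕ → ℕ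
count P? zero    = 0
count P? (suc n) = if does (P? n) then suc (count P? n) else count P? n

count-cong : ∀ {P Q : Pred ℕ 0ℓ} (P? : Decidable P) (Q? : Decidable Q) n →
             (∀ {y} → y < n → P y ⇔ Q y) → count P? n ≡ count Q? n
count-cong P? Q? zero    _   = refl
count-cong P? Q? (suc n) P⇔Q rewrite does-⇔ (P⇔Q ≤-refl) (P? n) (Q? n) =
  cong (λ c → if does (Q? n) then suc c else c)
       (count-cong P? Q? n (λ y<n → P⇔Q (m<n⇒m<1+n y<n)))

count-nonzero : ∀ {P : Pred ℕ 0ℓ} (P? : Decidable P) n {k} → count P? n ≡ suc k → ∃ λ x → x < n × P x
count-nonzero P? (suc n) eq with P? n
... | yes Pn = n , ≤-refl , Pn
... | no  _  with count-nonzero P? n eq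
...   | x , x<n , Px = x , m<n⇒m<1+n x<n , Px

count-≤? : ∀ a n → count (a ≤?_) n ≡ n ∸ a
count-≤? a zero    = sym (0∸n≡0 a)
count-≤? a (suc n) with a ≤? n
... | yes a≤n rewrite dec-true (a ≤? n) a≤n = trans (cong suc (count-≤? a n)) (sym (+-∸-assoc 1 a≤n))
... | no  a≰n rewrite dec-false (a ≤? n) a≰n =
  trans (count-≤? a n) (trans (m≤n⇒m∸n≡0 (<⇒≤ n<a)) (sym (m≤n⇒m∸n≡0 n<a)))
  where n<a = ≰⇒> a≰n

infixl 5 _∖_ _∖?_

_∖_ : Pred ℕ 0ℓ → ℕ → Pred ℕ 0ℓ
(P ∖ x) y = P y × y ≢ x

_∖?_ : ∀ {P} → Decidable P → ∀ x → Decidable (P ∖ x)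
(P? ∖? x) y = P? y ×-dec ¬? (y ≟ x)

count-remove : ∀ {P : Pred ℕ 0ℓ} (P? : Decidable P) n {x} → x < n → P x →
               count P? n ≡ suc (count (P? ∖? x) n)
count-remove P? (suc n) {x} x<1+n Px with x ≟ n
... | yes refl rewrite dec-true (x ≟ x) refl | dec-true (P? x) Px =
  cong suc (count-cong P? (P? ∖? x) x λ y<x → mk⇔ (λ Py → Py , <⇒≢ y<x) proj₁)
count-remove P? (suc n) {x} x<1+n Px | no x≢n
  rewrite dec-false (n ≟ x) (≢-sym x≢n)
        | count-remove P? n (≤∧≢⇒< (≤-pred x<1+n) x≢n) Px
  with does (P? n)
...   | true  = refl
...   | false = refl

FixedPointFreeInvolution : Pred ℕ 0ℓ → ℕ → (ℕ → ℕ) → Set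
FixedPointFreeInvolution P n σ =
  ∀ {x} → x < n → P x → σ x < n × P (σ x) × σ (σ x) ≡ x × σ x ≢ x

module _ (n : ℕ) (σ : ℕ → ℕ) where

  remove-orbit : ∀ {P} (P? : Decidable P) → FixedPointFreeInvolution P n σ → ∀ {x} → x < n → P x →
                 FixedPointFreeInvolution (P ∖ x ∖ σ x) n σ × count P? n ≡ 2 + count (P? ∖? x ∖? σ x) n
  remove-orbit P? inv {x} x<n Px with inv x<n Px
  ... | σx<n , Pσx , σσx≡x , σx≢x = inv′ , total
    where
    total = trans (count-remove P? n x<n Px) (cong suc (count-remove (P? ∖? x) n σx<n (Pσx , σx≢x)))
    inv′ : FixedPointFreeInvolution (_ ∖ x ∖ σ x) n σ
    inv′ y<n ((Py , y≢x) , y≢σx) with inv y<n Py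
    ... | σy<n , Pσy , σσy≡y , σy≢y =
      σy<n ,
      ((Pσy , λ σy≡x → y≢σx (trans (sym σσy≡y) (cong σ σy≡x))) ,
       λ σy≡σx → y≢x (trans (sym σσy≡y) (trans (cong σ σy≡σx) σσx≡x))) ,
      σσy≡y , σy≢y

  even-count : ∀ {P} (P? : Decidable P) → FixedPointFreeInvolution P n σ → 2 ∣ count P? n
  even-count P? inv = go P? inv _ refl
    where
    go : ∀ {P} (P? : Decidable P) → FixedPointFreeInvolution P n σ → ∀ k → count P? n ≡ k → 2 ∣ k
    go P? inv zero    _  = 2 ∣0
    go P? inv (suc k) eq with count-nonzero P? n eq
    ... | x , x<n , Px with remove-orbit P? inv x<n Px
    ... | inv′ , total = step k (suc-injective (trans (sym eq) total))
      where
      step : ∀ k → k ≡ suc (count (P? ∖? x ∖? σ x) n) → 2 ∣ suc k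
      step zero    ()
      step (suc k) e = ∣m∣n⇒∣m+n ∣-refl (go _ inv′ k (sym (suc-injective e)))


-- Arithmetic modulo a prime

%4≡1∧∣4⇒≡1 : ∀ {p} → p % 4 ≡ 1 → p ∣ 4 → p ≡ 1
%4≡1∧∣4⇒≡1 {p} p%4≡1 p∣4 = go p (∣⇒≤ p∣4) p%4≡1
  where
  go : ∀ p → p ≤ 4 → p % 4 ≡ 1 → p ≡ 1
  go 1 _ _ = refl
  go (suc (suc (suc (suc (suc _))))) (s≤s (s≤s (s≤s (s≤s ())))) _

module PrimeModulus {p : ℕ} (prime : Prime p) where

  instance
    p≢0 : NonZero p
    p≢0 = prime⇒nonZero prime

  open Congruence p

  1<p : 1 < p
  1<p = nonTrivial⇒n>1 p {{prime⇒nonTrivial prime}}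

  0<x<p⇒x≉0 : ∀ {x} → 0 < x → x < p → ¬ x ≈ 0
  0<x<p⇒x≉0 {suc _} _ x<p x≈0 = >⇒∤ x<p (≈0⇒∣ x≈0)

  euclidsLemma-≈ : ∀ x y → x * y ≈ 0 → x ≈ 0 ⊎ y ≈ 0
  euclidsLemma-≈ x y xy≈0 with euclidsLemma x y prime (≈0⇒∣ xy≈0)
  ... | inj₁ p∣x = inj₁ (∣⇒≈0 p∣x)
  ... | inj₂ p∣y = inj₂ (∣⇒≈0 p∣y)

  inverse-exists : ∀ {x} → 0 < x → x < p → ∃ λ y → x * y ≈ 1
  inverse-exists {x@(suc _)} _ x<p with coprime-Bézout (prime⇒coprime prime x<p)
  ... | Bézout.-+ a b 1+ap≡bx = b , mk≈ (begin
    (x * b) % p        ≡⟨ cong (_% p) (trans (*-comm x b) (sym 1+ap≡bx)) ⟩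
    (1 + a * p) % p    ≡⟨ [m+kn]%n≡m%n 1 a p ⟩
    1 % p              ∎)
    where open ≡-Reasoning
  ... | Bézout.+- a b 1+bx≡ap = b * (p ∸ 1) , (begin
    x * (b * (p ∸ 1))   ≡⟨ swap x b (p ∸ 1) ⟩
    b * x * (p ∸ 1)     ≈⟨ *-congʳ (p ∸ 1) bx≈p∸1 ⟩
    (p ∸ 1) * (p ∸ 1)   ≈⟨ [m∸1]²≈1 ⟩
    1                   ∎)
    where
    open ≈-Reasoning
    swap : ∀ x b c → x * (b * c) ≡ b * x * c
    swap = solve-∀
    bx≈p∸1 : b * x ≈ p ∸ 1
    bx≈p∸1 = +-cancelˡ 1 (begin
      1 + b * x         ≈⟨ ∣⇒≈0 (divides a 1+bx≡ap) ⟩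
      0                 ≈⟨ m≈0 ⟨
      p                 ≡⟨ m+[n∸m]≡n (<⇒≤ 1<p) ⟨
      1 + (p ∸ 1)       ∎)

  -- found by search, with junk value 0 when x has no inverse
  inverse : ℕ → ℕ
  inverse x with any? (λ (y : Fin p) → x * toℕ y ≈? 1)
  ... | yes (y , _) = toℕ y
  ... | no  _       = 0

  inverse-spec : ∀ {x} → 0 < x → x < p → inverse x < p × x * inverse x ≈ 1
  inverse-spec {x} x>0 x<p with any? (λ (y : Fin p) → x * toℕ y ≈? 1)
  ... | yes (y , xy≈1) = toℕ<n y , xy≈1
  ... | no  ∄y         = contradiction (y mod p , x*[y%p]≈1) ∄y
    where
    y = proj₁ (inverse-exists x>0 x<p)
    x*[y%p]≈1 : x * toℕ (y mod p) ≈ 1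
    x*[y%p]≈1 = begin
      x * toℕ (y mod p)   ≡⟨ cong (x *_) (toℕ-fromℕ< (m%n<n y p)) ⟩
      x * (y % p)         ≈⟨ *-congˡ x (%-≈ y) ⟩
      x * y               ≈⟨ proj₂ (inverse-exists x>0 x<p) ⟩
      1                   ∎
      where open ≈-Reasoning

  *≈1⇒inverse≡ : ∀ {x y} → 0 < x → x < p → y < p → x * y ≈ 1 → inverse x ≡ y
  *≈1⇒inverse≡ {x} x>0 x<p y<p xy≈1 with inverse-spec x>0 x<p
  ... | inv<p , x*inv≈1 = ≈∧<⇒≡ inv<p y<p (inverse-unique x x*inv≈1 xy≈1)

  square-root-of-one : ∀ {x} → 0 < x → x * x ≈ 1 → x ∸ 1 ≈ 0 ⊎ x + 1 ≈ 0
  square-root-of-one {x@(suc x′)} _ x²≈1 = euclidsLemma-≈ (x ∸ 1) (x + 1) (+-cancelʳ 1 (begin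
    x′ * (x + 1) + 1   ≡⟨ factor x′ ⟩
    x * x              ≈⟨ x²≈1 ⟩
    0 + 1              ∎))
    where
    open ≈-Reasoning
    factor : ∀ x′ → x′ * (suc x′ + 1) + 1 ≡ suc x′ * suc x′
    factor = solve-∀

  module NoSquareRootOfMinusOne {q : ℕ} (p≡1+q*4 : p ≡ 1 + q * 4)
           (no-root : ∀ {r} → r < p → ¬ r * r + 1 ≈ 0) where

    h : ℕ
    h = q * 2

    p≡1+h+h : p ≡ suc (h + h)
    p≡1+h+h = trans p≡1+q*4 (cong suc (q*4≡q*2+q*2 q))
      where
      q*4≡q*2+q*2 : ∀ q → q * 4 ≡ q * 2 + q * 2
      q*4≡q*2+q*2 = solve-∀

    ≤h⇒+≤p : ∀ {z w} → z ≤ h → w ≤ h → z + w < p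
    ≤h⇒+≤p z≤h w≤h = subst (_ <_) (sym p≡1+h+h) (s≤s (+-mono-≤ z≤h w≤h))

    fold : ℕ → ℕ
    fold z = z ⊓ (p ∸ z)

    fold-small : ∀ {z} → z ≤ h → fold z ≡ z
    fold-small {z} z≤h = m≤n⇒m⊓n≡m (m+n≤o⇒m≤o∸n z (<⇒≤ (≤h⇒+≤p z≤h z≤h)))

    fold-neg : ∀ {z} → z ≤ p → fold (p ∸ z) ≡ fold z
    fold-neg {z} z≤p = trans (cong ((p ∸ z) ⊓_) (m∸[m∸n]≡n z≤p)) (⊓-comm (p ∸ z) z)

    fold-range : ∀ {z} → 2 ≤ z → 2 + z ≤ p → 2 ≤ fold z × fold z ≤ h
    fold-range {z} 2≤z 2+z≤p = ⊓-glb 2≤z (m+n≤o⇒m≤o∸n 2 2+z≤p) , fold≤h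
      where
      fold≤h : fold z ≤ h
      fold≤h with z ≤? h
      ... | yes z≤h = ≤-trans (m⊓n≤m z (p ∸ z)) z≤h
      ... | no  z≰h = begin
        fold z         ≤⟨ m⊓n≤n z (p ∸ z) ⟩
        p ∸ z          ≤⟨ ∸-monoʳ-≤ p (≰⇒> z≰h) ⟩
        p ∸ suc h      ≡⟨ cong (_∸ suc h) p≡1+h+h ⟩
        (h + h) ∸ h    ≡⟨ m+n∸m≡n h h ⟩
        h              ∎
        where open ≤-Reasoning

    σ : ℕ → ℕ
    σ x = fold (inverse x)

    module _ {x} (2≤x : 2 ≤ x) (x≤h : x ≤ h) where

      x<p : x < p
      x<p = ≤-<-trans (m≤m+n x x) (≤h⇒+≤p x≤h x≤h)

      x>0 : 0 < x
      x>0 = ≤-trans (s≤s z≤n) 2≤x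

      y = inverse x

      y<p : y < p
      y<p = proj₁ (inverse-spec x>0 x<p)

      xy≈1 : x * y ≈ 1
      xy≈1 = proj₂ (inverse-spec x>0 x<p)

      2≤y : 2 ≤ y
      2≤y with y | xy≈1
      ... | 0           | x*0≈1 = contradiction (≈-trans (≈-reflexive (sym (*-zeroʳ x))) x*0≈1) (1≉0 1<p ∘ ≈-sym)
      ... | 1           | x*1≈1 = contradiction (≈∧<⇒≡ x<p 1<p (≈-trans (≈-reflexive (sym (*-identityʳ x))) x*1≈1))
                                              λ { refl → <⇒≱ 2≤x ≤-refl }
      ... | suc (suc _) | _     = s≤s (s≤s z≤n)

      2+y≤p : 2 + y ≤ p
      2+y≤p = ≤∧≢⇒< y<p 1+y≢p
        where
        1+y≢p : suc y ≢ p
        1+y≢p 1+y≡p = <-irrefl refl (begin-strict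
          p          ≡⟨ 1+y≡p ⟨
          suc y      ≡⟨ cong suc y≡x ⟩
          suc x      ≤⟨ s≤s x≤h ⟩
          suc h      <⟨ s≤s (m<m+n h (≤-trans (s≤s z≤n) (≤-trans 2≤x x≤h))) ⟩
          suc (h + h) ≡⟨ p≡1+h+h ⟨
          p          ∎)
          where
          open ≤-Reasoning
          y*y≈1 : y * y ≈ 1
          y*y≈1 = subst (λ z → z * z ≈ 1) (sym (cong (_∸ 1) 1+y≡p)) [m∸1]²≈1
          y≡x : y ≡ x
          y≡x = ≈∧<⇒≡ y<p x<p (inverse-unique y y*y≈1 (≈-trans (≈-reflexive (*-comm y x)) xy≈1))

      y>0 : 0 < y
      y>0 = ≤-trans (s≤s z≤n) 2≤y

      σ-range : 2 ≤ σ x × σ x ≤ h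
      σ-range = fold-range 2≤y 2+y≤p

      inverse-σ : inverse (σ x) ≡ x ⊎ inverse (σ x) ≡ p ∸ x
      inverse-σ with ⊓-sel y (p ∸ y)
      ... | inj₁ fold≡y   = inj₁ (trans (cong inverse fold≡y)
                                  (*≈1⇒inverse≡ y>0 y<p x<p yx≈1))
        where yx≈1 = ≈-trans (≈-reflexive (*-comm y x)) xy≈1
      ... | inj₂ fold≡p∸y = inj₂ (trans (cong inverse fold≡p∸y)
                                  (*≈1⇒inverse≡ (m<n⇒0<n∸m y<p) (∸-monoʳ-< y>0 (<⇒≤ y<p))
                                                   (∸-monoʳ-< x>0 (<⇒≤ x<p)) [p∸y][p∸x]≈1))
        where
        [p∸y][p∸x]≈1 : (p ∸ y) * (p ∸ x) ≈ 1
        [p∸y][p∸x]≈1 = ≈-trans ([m∸a]*[m∸b]≈a*b (<⇒≤ y<p) (<⇒≤ x<p)) (≈-trans (≈-reflexive (*-comm y x)) xy≈1)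

      σ-involutive : σ (σ x) ≡ x
      σ-involutive with inverse-σ
      ... | inj₁ inv≡x   = trans (cong fold inv≡x) (fold-small x≤h)
      ... | inj₂ inv≡p∸x = trans (cong fold inv≡p∸x) (trans (fold-neg (<⇒≤ x<p)) (fold-small x≤h))

      σ-fixed-point-free : σ x ≢ x
      σ-fixed-point-free σx≡x with ⊓-sel y (p ∸ y)
      ... | inj₁ fold≡y with square-root-of-one x>0 (subst (λ z → x * z ≈ 1) (trans (sym fold≡y) σx≡x) xy≈1)
      ...   | inj₁ x∸1≈0 = 0<x<p⇒x≉0 (m<n⇒0<n∸m 2≤x) (≤-<-trans (m∸n≤m x 1) x<p) x∸1≈0
      ...   | inj₂ x+1≈0 = 0<x<p⇒x≉0 (m<m+n 0 {x + 1} (m≤n+m 1 x)) (≤h⇒+≤p x≤h 1≤h) x+1≈0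
        where 1≤h = ≤-trans (s≤s z≤n) (≤-trans 2≤x x≤h)
      σ-fixed-point-free σx≡x | inj₂ fold≡p∸y = no-root x<p (begin
        x * x + 1          ≈⟨ +-congˡ (x * x) xy≈1 ⟨
        x * x + x * y      ≡⟨ *-distribˡ-+ x x y ⟨
        x * (x + y)        ≡⟨ cong (λ z → x * (z + y)) (trans (sym σx≡x) fold≡p∸y) ⟩
        x * (p ∸ y + y)    ≡⟨ cong (x *_) (m∸n+n≡m (<⇒≤ y<p)) ⟩
        x * p              ≈⟨ *-congˡ x m≈0 ⟩
        x * 0              ≡⟨ *-zeroʳ x ⟩
        0                  ∎)
        where open ≈-Reasoning

    σ-fixed-point-free-involution : FixedPointFreeInvolution (2 ≤_) (suc h) σ
    σ-fixed-point-free-involution {x} x<1+h 2≤x =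
      s≤s (proj₂ (σ-range 2≤x x≤h)) , proj₁ (σ-range 2≤x x≤h) , σ-involutive 2≤x x≤h , σ-fixed-point-free 2≤x x≤h
      where x≤h = ≤-pred x<1+h

    q≢0 : q ≢ 0
    q≢0 q≡0 = ¬prime[1] (subst Prime (trans p≡1+q*4 (cong (λ q → 1 + q * 4) q≡0)) prime)

    absurd : ⊥
    absurd = odd q q≢0 (subst (2 ∣_) (count-≤? 2 (suc h))
                          (even-count (suc h) σ (2 ≤?_) σ-fixed-point-free-involution))
      where
      odd : ∀ q → q ≢ 0 → ¬ 2 ∣ suc (q * 2) ∸ 2
      odd zero    q≢0 _  = q≢0 refl
      odd (suc q) _   2∣ = contradiction (∣1⇒≡1 (∣m+n∣m⇒∣n (subst (2 ∣_) (+-comm 1 (q * 2)) 2∣) (n∣m*n q))) λ ()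

  -1-is-square : p % 4 ≡ 1 → ∃ λ r → r * r + 1 ≈ 0
  -1-is-square p%4≡1 =
    Product.map toℕ id (decidable-stable (any? λ (r : Fin p) → toℕ r * toℕ r + 1 ≈? 0) ¬¬root)
    where
    ¬¬root : ¬ ¬ ∃ λ (r : Fin p) → toℕ r * toℕ r + 1 ≈ 0
    ¬¬root ∄r = NoSquareRootOfMinusOne.absurd {p / 4} p≡1+q*4 λ {r} r<p r²+1≈0 →
      ∄r (fromℕ< r<p , subst (λ s → s * s + 1 ≈ 0) (sym (toℕ-fromℕ< r<p)) r²+1≈0)
      where
      p≡1+q*4 : p ≡ 1 + p / 4 * 4
      p≡1+q*4 = trans (m≡m%n+[m/n]*n p 4) (cong (_+ p / 4 * 4) p%4≡1)


-- Ternary relational structures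

decRel3 : {V : Set} {P : V → V → V → Set} → (∀ x y z → Dec (P x y z)) → Rel3 V
decRel3 P? x y z = does (P? x y z)

module _ {V W : Set} {P : V → V → V → Set} {Q : W → W → W → Set}
         (P? : ∀ x y z → Dec (P x y z)) (Q? : ∀ x y z → Dec (Q x y z)) where

  mapsTo-of-⇔ : ∀ f → (∀ x y z → P x y z ⇔ Q (f x) (f y) (f z)) → MapsTo f (decRel3 P?) (decRel3 Q?)
  mapsTo-of-⇔ f P⇔Q x y z = does-⇔ (P⇔Q x y z) (P? x y z) (Q? (f x) (f y) (f z))

  mapsTo-preserves : ∀ {f} → MapsTo f (decRel3 P?) (decRel3 Q?) → ∀ {x y z} → P x y z → Q (f x) (f y) (f z)
  mapsTo-preserves {f} maps {x} {y} {z} Pxyz with Q? (f x) (f y) (f z) | maps x y z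
  ... | yes Qfxyz | _  = Qfxyz
  ... | no  _     | eq with () ← trans (sym (dec-true (P? x y z) Pxyz)) eq

module _ {V W : Set} {f : V → W} {R : Rel3 V} {R′ : Rel3 W} where

  isIso-singleton : Bijective _≡_ _≡_ f → MapsTo f R R′ → IsIso f (R ∷ []) (R′ ∷ [])
  isIso-singleton bij maps =
    bij , (λ { _ (here refl) → R′ , here refl , maps }) , (λ { _ (here refl) → R , here refl , maps })

  isIso-singleton⁻ : IsIso f (R ∷ []) (R′ ∷ []) → MapsTo f R R′
  isIso-singleton⁻ (_ , forth , _) with forth R (here refl)
  ... | _ , here refl , maps = maps

cong₃ : {A B : Set} (f : A → A → A → B) {x x′ y y′ z z′ : A} → x ≡ x′ → y ≡ y′ → z ≡ z′ → f x y z ≡ f x′ y′ z′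
cong₃ f refl refl refl = refl

bijective-resp-≗ : {A B : Set} {f g : A → B} → f ≗ g → Bijective _≡_ _≡_ f → Bijective _≡_ _≡_ g
bijective-resp-≗ {f = f} {g} f≗g (f-injective , f-surjective) =
  (λ {x} {y} gx≡gy → f-injective (trans (f≗g x) (trans gx≡gy (sym (f≗g y))))) ,
  strictlySurjective⇒surjective λ y → proj₁ (f-surjective y) , trans (sym (f≗g _)) (proj₂ (f-surjective y) refl)

module Transport {A B : Set} {_∙_ : A → A → A} {_⋆_ : B → B → B}
                 (ψ : A → B) (ψ⁻¹ : B → A)
                 (ψ⁻¹∘ψ : ∀ x → ψ⁻¹ (ψ x) ≡ x) (ψ∘ψ⁻¹ : ∀ y → ψ (ψ⁻¹ y) ≡ y)
                 (ψ-hom : ∀ x y → ψ (x ∙ y) ≡ ψ x ⋆ ψ y) where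

  ψ-bijective : Bijective _≡_ _≡_ ψ
  ψ-bijective = inverseᵇ⇒bijective (strictlyInverseˡ⇒inverseˡ ψ ψ∘ψ⁻¹ , strictlyInverseʳ⇒inverseʳ ψ ψ⁻¹∘ψ)

  ψ⁻¹-bijective : Bijective _≡_ _≡_ ψ⁻¹
  ψ⁻¹-bijective = inverseᵇ⇒bijective (strictlyInverseˡ⇒inverseˡ ψ⁻¹ ψ⁻¹∘ψ , strictlyInverseʳ⇒inverseʳ ψ⁻¹ ψ∘ψ⁻¹)

  ψ⁻¹-hom : ∀ x y → ψ⁻¹ (x ⋆ y) ≡ ψ⁻¹ x ∙ ψ⁻¹ y
  ψ⁻¹-hom x y = begin
    ψ⁻¹ (x ⋆ y)                    ≡⟨ cong₂ (λ u v → ψ⁻¹ (u ⋆ v)) (ψ∘ψ⁻¹ x) (ψ∘ψ⁻¹ y) ⟨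
    ψ⁻¹ (ψ (ψ⁻¹ x) ⋆ ψ (ψ⁻¹ y))     ≡⟨ cong ψ⁻¹ (ψ-hom (ψ⁻¹ x) (ψ⁻¹ y)) ⟨
    ψ⁻¹ (ψ (ψ⁻¹ x ∙ ψ⁻¹ y))         ≡⟨ ψ⁻¹∘ψ _ ⟩
    ψ⁻¹ x ∙ ψ⁻¹ y                  ∎
    where open ≡-Reasoning

  pull : Rel3 B → Rel3 A
  pull R x y z = R (ψ x) (ψ y) (ψ z)

  module _ {f : B → B} {f′ : A → A} (square : ∀ x → ψ (f′ x) ≡ f (ψ x)) where

    pull-mapsTo : ∀ {R R′} → MapsTo f R R′ → MapsTo f′ (pull R) (pull R′)
    pull-mapsTo {R′ = R′} maps x y z =
      trans (maps (ψ x) (ψ y) (ψ z)) (sym (cong₃ R′ (square x) (square y) (square z)))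

    pull-mapsTo⁻ : ∀ {R R′} → MapsTo f′ (pull R) (pull R′) → MapsTo f R R′
    pull-mapsTo⁻ {R} {R′} maps x y z = begin
      R x y z                                     ≡⟨ cong₃ R (ψ∘ψ⁻¹ x) (ψ∘ψ⁻¹ y) (ψ∘ψ⁻¹ z) ⟨
      pull R (ψ⁻¹ x) (ψ⁻¹ y) (ψ⁻¹ z)              ≡⟨ maps (ψ⁻¹ x) (ψ⁻¹ y) (ψ⁻¹ z) ⟩
      pull R′ (f′ (ψ⁻¹ x)) (f′ (ψ⁻¹ y)) (f′ (ψ⁻¹ z)) ≡⟨ cong₃ R′ (square′ x) (square′ y) (square′ z) ⟩
      R′ (f x) (f y) (f z)                        ∎
      where
      open ≡-Reasoning
      square′ : ∀ x → ψ (f′ (ψ⁻¹ x)) ≡ f x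
      square′ x = trans (square (ψ⁻¹ x)) (cong f (ψ∘ψ⁻¹ x))

    pull-isIso : ∀ {X Y} → Bijective _≡_ _≡_ f′ → IsIso f X Y → IsIso f′ (map pull X) (map pull Y)
    pull-isIso {X} {Y} bij (_ , forth , back) = bij , forth′ , back′
      where
      forth′ : ∀ R → R ∈ map pull X → ∃ λ R′ → R′ ∈ map pull Y × MapsTo f′ R R′
      forth′ R R∈ with ∈-map⁻ pull R∈
      ... | R₀ , R₀∈ , refl with forth R₀ R₀∈
      ...   | R₁ , R₁∈ , maps = pull R₁ , ∈-map⁺ pull R₁∈ , pull-mapsTo {R₀} {R₁} maps
      back′ : ∀ R′ → R′ ∈ map pull Y → ∃ λ R → R ∈ map pull X × MapsTo f′ R R′
      back′ R R∈ with ∈-map⁻ pull R∈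
      ... | R₀ , R₀∈ , refl with back R₀ R₀∈
      ...   | R₁ , R₁∈ , maps = pull R₁ , ∈-map⁺ pull R₁∈ , pull-mapsTo {R₁} {R₀} maps

    pull-isIso⁻ : ∀ {X Y} → Bijective _≡_ _≡_ f → IsIso f′ (map pull X) (map pull Y) → IsIso f X Y
    pull-isIso⁻ {X} {Y} bij (_ , forth , back) = bij , forth′ , back′
      where
      forth′ : ∀ R → R ∈ X → ∃ λ R′ → R′ ∈ Y × MapsTo f R R′
      forth′ R R∈ with forth (pull R) (∈-map⁺ pull R∈)
      ... | R₁ , R₁∈ , maps with ∈-map⁻ pull R₁∈
      ...   | R₂ , R₂∈ , refl = R₂ , R₂∈ , pull-mapsTo⁻ {R} {R₂} maps
      back′ : ∀ R′ → R′ ∈ Y → ∃ λ R → R ∈ X × MapsTo f R R′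
      back′ R R∈ with back (pull R) (∈-map⁺ pull R∈)
      ... | R₁ , R₁∈ , maps with ∈-map⁻ pull R₁∈
      ...   | R₂ , R₂∈ , refl = R₂ , R₂∈ , pull-mapsTo⁻ {R₂} {R} maps

  conjugate-bijective : ∀ {f} → Bijective _≡_ _≡_ f → Bijective _≡_ _≡_ (ψ⁻¹ ∘ f ∘ ψ)
  conjugate-bijective f-bij =
    Composition.bijective _≡_ _≡_ _≡_ ψ-bijective (Composition.bijective _≡_ _≡_ _≡_ f-bij ψ⁻¹-bijective)

  conjugate⁻¹-bijective : ∀ {f} → Bijective _≡_ _≡_ f → Bijective _≡_ _≡_ (ψ ∘ f ∘ ψ⁻¹)
  conjugate⁻¹-bijective f-bij =
    Composition.bijective _≡_ _≡_ _≡_ ψ⁻¹-bijective (Composition.bijective _≡_ _≡_ _≡_ f-bij ψ-bijective)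

  pull-cayley : ∀ {X} → IsCayley _⋆_ X → IsCayley _∙_ (map pull X)
  pull-cayley cay g = pull-isIso (ψ-hom g) (bijective-resp-≗ conjugate≗ (conjugate-bijective (proj₁ (cay (ψ g)))))
                                (cay (ψ g))
    where
    conjugate≗ : ∀ x → ψ⁻¹ (ψ g ⋆ ψ x) ≡ g ∙ x
    conjugate≗ x = trans (cong ψ⁻¹ (sym (ψ-hom g x))) (ψ⁻¹∘ψ (g ∙ x))

  isCI3-transport : IsCI3 A _∙_ → IsCI3 B _⋆_
  isCI3-transport ci X Y cayX cayY (f , f-iso)
    with ci (map pull X) (map pull Y) (pull-cayley cayX) (pull-cayley cayY)
            (ψ⁻¹ ∘ f ∘ ψ , pull-isIso (λ x → ψ∘ψ⁻¹ (f (ψ x))) (conjugate-bijective (proj₁ f-iso)) f-iso)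
  ... | α , (α-bij , α-hom) , α-iso = ψ ∘ α ∘ ψ⁻¹ , (α′-bij , α′-hom) , pull-isIso⁻ square α′-bij α-iso
    where
    α′-bij = conjugate⁻¹-bijective α-bij
    α′-hom : ∀ x y → ψ (α (ψ⁻¹ (x ⋆ y))) ≡ ψ (α (ψ⁻¹ x)) ⋆ ψ (α (ψ⁻¹ y))
    α′-hom x y = trans (cong (ψ ∘ α) (ψ⁻¹-hom x y)) (trans (cong ψ (α-hom _ _)) (ψ-hom _ _))
    square : ∀ x → ψ (α x) ≡ ψ (α (ψ⁻¹ (ψ x)))
    square x = cong (ψ ∘ α) (sym (ψ⁻¹∘ψ x))


-- Linear equations in three unknowns

record LinearForm : Set where
  constructor ⟨_,_,_⟩
  field c₁ c₂ c₃ : ℕ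

eval : LinearForm → ℕ → ℕ → ℕ → ℕ
eval ⟨ a , b , c ⟩ x y z = a * x + b * y + c * z

coefficient-sum : LinearForm → ℕ
coefficient-sum ⟨ a , b , c ⟩ = a + b + c

infix 4 _≐_
record LinearEquation : Set where
  constructor _≐_
  field lhs rhs : LinearForm

twist : ℕ → LinearEquation → LinearEquation
twist r (l ≐ l′) = tw l ≐ tw l′
  where
  tw : LinearForm → LinearForm
  tw ⟨ a , b , c ⟩ = ⟨ a , r * b , r * r * c ⟩

eval-translate : ∀ l c x y z → eval l (c + x) (c + y) (c + z) ≡ coefficient-sum l * c + eval l x y z
eval-translate ⟨ a , b , d ⟩ = lemma a b d
  where
  lemma : ∀ a b d c x y z → a * (c + x) + b * (c + y) + d * (c + z) ≡ (a + b + d) * c + (a * x + b * y + d * z)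
  lemma = solve-∀

eval-scale : ∀ l t x y z → eval l (t * x) (t * y) (t * z) ≡ t * eval l x y z
eval-scale ⟨ a , b , c ⟩ = lemma a b c
  where
  lemma : ∀ a b c t x y z → a * (t * x) + b * (t * y) + c * (t * z) ≡ t * (a * x + b * y + c * z)
  lemma = solve-∀

eval-zero : ∀ l → eval l 0 0 0 ≡ 0
eval-zero ⟨ a , b , c ⟩ = lemma a b c
  where
  lemma : ∀ a b c → a * 0 + b * 0 + c * 0 ≡ 0
  lemma = solve-∀

module LinearEquations (m : ℕ) .{{_ : NonZero m}} where

  open Congruence m

  Solves : LinearEquation → ℕ → ℕ → ℕ → Set
  Solves (l ≐ l′) x y z = eval l x y z ≈ eval l′ x y z

  solves? : ∀ E x y z → Dec (Solves E x y z)
  solves? (l ≐ l′) x y z = eval l x y z ≈? eval l′ x y z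

  Balanced : LinearEquation → Set
  Balanced (l ≐ l′) = coefficient-sum l ≈ coefficient-sum l′

  eval-cong : ∀ l {x x′ y y′ z z′} → x ≈ x′ → y ≈ y′ → z ≈ z′ → eval l x y z ≈ eval l x′ y′ z′
  eval-cong ⟨ a , b , c ⟩ x≈x′ y≈y′ z≈z′ =
    +-cong (+-cong (*-congˡ a x≈x′) (*-congˡ b y≈y′)) (*-congˡ c z≈z′)

  solves-resp-≈ : ∀ E {x x′ y y′ z z′} → x ≈ x′ → y ≈ y′ → z ≈ z′ → Solves E x y z → Solves E x′ y′ z′
  solves-resp-≈ (l ≐ l′) x≈x′ y≈y′ z≈z′ sol =
    ≈-trans (≈-sym (eval-cong l x≈x′ y≈y′ z≈z′)) (≈-trans sol (eval-cong l′ x≈x′ y≈y′ z≈z′))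

  solves-⇔-resp-≈ : ∀ E {x x′ y y′ z z′} → x ≈ x′ → y ≈ y′ → z ≈ z′ → Solves E x y z ⇔ Solves E x′ y′ z′
  solves-⇔-resp-≈ E x≈x′ y≈y′ z≈z′ =
    mk⇔ (solves-resp-≈ E x≈x′ y≈y′ z≈z′) (solves-resp-≈ E (≈-sym x≈x′) (≈-sym y≈y′) (≈-sym z≈z′))

  solves-translate : ∀ E c {x y z} → Balanced E → Solves E x y z ⇔ Solves E (c + x) (c + y) (c + z)
  solves-translate (l ≐ l′) c {x} {y} {z} bal = mk⇔
    (λ sol → begin
      eval l (c + x) (c + y) (c + z)                ≡⟨ eval-translate l c x y z ⟩
      coefficient-sum l * c + eval l x y z          ≈⟨ +-cong (*-congʳ c bal) sol ⟩
      coefficient-sum l′ * c + eval l′ x y z        ≡⟨ eval-translate l′ c x y z ⟨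
      eval l′ (c + x) (c + y) (c + z)               ∎)
    (λ sol → +-cancelˡ (coefficient-sum l′ * c) (begin
      coefficient-sum l′ * c + eval l x y z         ≈⟨ +-congʳ (eval l x y z) (*-congʳ c bal) ⟨
      coefficient-sum l * c + eval l x y z          ≡⟨ eval-translate l c x y z ⟨
      eval l (c + x) (c + y) (c + z)                ≈⟨ sol ⟩
      eval l′ (c + x) (c + y) (c + z)               ≡⟨ eval-translate l′ c x y z ⟩
      coefficient-sum l′ * c + eval l′ x y z        ∎))
    where open ≈-Reasoning

  solves-scale : ∀ E t t′ {x y z} → t′ * t ≈ 1 → Solves E x y z ⇔ Solves E (t * x) (t * y) (t * z)
  solves-scale (l ≐ l′) t t′ {x} {y} {z} t′t≈1 = mk⇔
    (λ sol → ≈-trans (≈-reflexive (eval-scale l t x y z))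
               (≈-trans (*-congˡ t sol) (≈-reflexive (sym (eval-scale l′ t x y z)))))
    (λ sol → *-cancelˡ-unit t t′ t′t≈1
               (≈-trans (≈-reflexive (sym (eval-scale l t x y z)))
               (≈-trans sol (≈-reflexive (eval-scale l′ t x y z)))))

  solves-twist : ∀ E r {x y z} → Solves (twist r E) x y z ⇔ Solves E x (r * y) (r * r * z)
  solves-twist (⟨ a , b , c ⟩ ≐ ⟨ a′ , b′ , c′ ⟩) r {x} {y} {z} = mk⇔
    (λ sol → ≈-trans (≈-reflexive (sym (twisted a b c))) (≈-trans sol (≈-reflexive (twisted a′ b′ c′))))
    (λ sol → ≈-trans (≈-reflexive (twisted a b c)) (≈-trans sol (≈-reflexive (sym (twisted a′ b′ c′)))))
    where
    twisted : ∀ a b c → a * x + r * b * y + r * r * c * z ≡ a * x + b * (r * y) + c * (r * r * z)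
    twisted a b c = lemma a b c r x y z
      where
      lemma : ∀ a b c r x y z → a * x + r * b * y + r * r * c * z ≡ a * x + b * (r * y) + c * (r * r * z)
      lemma = solve-∀

  solves-zero : ∀ E → Solves E 0 0 0
  solves-zero (l ≐ l′) = ≈-reflexive (trans (eval-zero l) (sym (eval-zero l′)))


-- The semidirect product ℤₚ ⋊ ℤ₄

toℕ-reduce : ∀ {n} .{{_ : NonZero n}} (a : Fin n) k → toℕ (reduce a k) ≡ k % n
toℕ-reduce {suc n} _ k = toℕ-fromℕ< (m%n<n k (suc n))

toℕ-addMod : ∀ {n} .{{_ : NonZero n}} (a b : Fin n) → toℕ (addMod a b) ≡ (toℕ a + toℕ b) % n
toℕ-addMod a b = toℕ-reduce a (toℕ a + toℕ b)

toℕ-mod : ∀ k n .{{_ : NonZero n}} → toℕ (k mod n) ≡ k % n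
toℕ-mod k n = toℕ-fromℕ< (m%n<n k n)

module SemidirectProduct (p : ℕ) .{{_ : NonZero p}} (ρ : ℕ) where

  open Congruence p
  module ℤ₄ = Congruence 4
  open ℤ₄ using () renaming (_≈_ to _≈₄_)

  G : Set
  G = Fin p × Fin 4

  infixl 7 _·_
  _·_ : G → G → G
  _·_ = sdOp ρ

  ⟦_⟧ₚ : G → ℕ
  ⟦ a , _ ⟧ₚ = toℕ a

  ⟦_⟧₄ : G → ℕ
  ⟦ _ , b ⟧₄ = toℕ b

  mk : ℕ → ℕ → G
  mk a b = a mod p , b mod 4

  e : G
  e = mk 0 0

  ⟦mk⟧ₚ : ∀ a b → ⟦ mk a b ⟧ₚ ≈ a
  ⟦mk⟧ₚ a b = ≈-trans (≈-reflexive (toℕ-mod a p)) (%-≈ a)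

  ⟦mk⟧₄ : ∀ a b → ⟦ mk a b ⟧₄ ≈₄ b
  ⟦mk⟧₄ a b = ℤ₄.≈-trans (ℤ₄.≈-reflexive (toℕ-mod b 4)) (ℤ₄.%-≈ b)

  ⟦mk0⟧ₚ : ∀ b → ⟦ mk 0 b ⟧ₚ ≡ 0
  ⟦mk0⟧ₚ b = trans (toℕ-mod 0 p) 0%m≡0

  ⟦e⟧ₚ : ⟦ e ⟧ₚ ≡ 0
  ⟦e⟧ₚ = ⟦mk0⟧ₚ 0

  ⟦·⟧ₚ : ∀ x y → ⟦ x · y ⟧ₚ ≈ ⟦ x ⟧ₚ + ρ ^ ⟦ x ⟧₄ * ⟦ y ⟧ₚ
  ⟦·⟧ₚ (a , _) _ = ≈-trans (≈-reflexive (toℕ-reduce a _)) (%-≈ _)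

  ⟦·⟧₄ : ∀ x y → ⟦ x · y ⟧₄ ≈₄ ⟦ x ⟧₄ + ⟦ y ⟧₄
  ⟦·⟧₄ (_ , b) (_ , d) = ℤ₄.≈-trans (ℤ₄.≈-reflexive (toℕ-addMod b d)) (ℤ₄.%-≈ _)

  ⟦⟧-injective : ∀ {x y} → ⟦ x ⟧ₚ ≈ ⟦ y ⟧ₚ → ⟦ x ⟧₄ ≈₄ ⟦ y ⟧₄ → x ≡ y
  ⟦⟧-injective {a , b} {c , d} a≈c b≈d =
    cong₂ _,_ (toℕ-injective (≈∧<⇒≡ (toℕ<n a) (toℕ<n c) a≈c))
              (toℕ-injective (ℤ₄.≈∧<⇒≡ (toℕ<n b) (toℕ<n d) b≈d))

  ⟦⟧₄≤4 : ∀ x → ⟦ x ⟧₄ ≤ 4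
  ⟦⟧₄≤4 (_ , b) = <⇒≤ (toℕ<n b)

  ·-identityʳ : ∀ x → x · e ≡ x
  ·-identityʳ x = ⟦⟧-injective
    (begin
      ⟦ x · e ⟧ₚ                  ≈⟨ ⟦·⟧ₚ x e ⟩
      ⟦ x ⟧ₚ + ρ ^ ⟦ x ⟧₄ * ⟦ e ⟧ₚ  ≡⟨ cong (λ z → ⟦ x ⟧ₚ + ρ ^ ⟦ x ⟧₄ * z) ⟦e⟧ₚ ⟩
      ⟦ x ⟧ₚ + ρ ^ ⟦ x ⟧₄ * 0       ≡⟨ cong (⟦ x ⟧ₚ +_) (*-zeroʳ (ρ ^ ⟦ x ⟧₄)) ⟩
      ⟦ x ⟧ₚ + 0                   ≡⟨ +-identityʳ ⟦ x ⟧ₚ ⟩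
      ⟦ x ⟧ₚ                       ∎)
    (ℤ₄.≈-trans (⟦·⟧₄ x e) (ℤ₄.≈-reflexive (+-identityʳ ⟦ x ⟧₄)))
    where open ≈-Reasoning

  ⟦·⟧ₚ-of-⟦⟧₄≡0 : ∀ {x} y → ⟦ x ⟧₄ ≡ 0 → ⟦ x · y ⟧ₚ ≈ ⟦ x ⟧ₚ + ⟦ y ⟧ₚ
  ⟦·⟧ₚ-of-⟦⟧₄≡0 {x} y ⟦x⟧₄≡0 = ≈-trans (⟦·⟧ₚ x y)
    (≈-reflexive (cong (⟦ x ⟧ₚ +_) (trans (cong (λ k → ρ ^ k * ⟦ y ⟧ₚ) ⟦x⟧₄≡0) (*-identityˡ ⟦ y ⟧ₚ))))

  infixr 8 _^ᴳ_
  _^ᴳ_ : G → ℕ → G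
  x ^ᴳ zero  = e
  x ^ᴳ suc k = x ^ᴳ k · x

  ⟦^⟧₄ : ∀ x k → ⟦ x ^ᴳ k ⟧₄ ≈₄ k * ⟦ x ⟧₄
  ⟦^⟧₄ x zero    = ℤ₄.≈-refl
  ⟦^⟧₄ x (suc k) = ℤ₄.≈-trans (⟦·⟧₄ (x ^ᴳ k) x)
    (ℤ₄.≈-trans (ℤ₄.+-congʳ ⟦ x ⟧₄ (⟦^⟧₄ x k)) (ℤ₄.≈-reflexive (+-comm (k * ⟦ x ⟧₄) ⟦ x ⟧₄)))

  ⟦^⟧₄-of-⟦⟧₄≡0 : ∀ x k → ⟦ x ⟧₄ ≡ 0 → ⟦ x ^ᴳ k ⟧₄ ≡ 0
  ⟦^⟧₄-of-⟦⟧₄≡0 x k ⟦x⟧₄≡0 = ℤ₄.≈∧<⇒≡ (toℕ<n (proj₂ (x ^ᴳ k))) (s≤s z≤n)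
    (ℤ₄.≈-trans (⟦^⟧₄ x k) (ℤ₄.≈-reflexive (trans (cong (k *_) ⟦x⟧₄≡0) (*-zeroʳ k))))

  ⟦^⟧ₚ-of-⟦⟧₄≡0 : ∀ x k → ⟦ x ⟧₄ ≡ 0 → ⟦ x ^ᴳ k ⟧ₚ ≈ k * ⟦ x ⟧ₚ
  ⟦^⟧ₚ-of-⟦⟧₄≡0 x zero    _ = ≈-reflexive ⟦e⟧ₚ
  ⟦^⟧ₚ-of-⟦⟧₄≡0 x (suc k) ⟦x⟧₄≡0 = ≈-trans (⟦·⟧ₚ-of-⟦⟧₄≡0 x (⟦^⟧₄-of-⟦⟧₄≡0 x k ⟦x⟧₄≡0))
    (≈-trans (+-congʳ ⟦ x ⟧ₚ (⟦^⟧ₚ-of-⟦⟧₄≡0 x k ⟦x⟧₄≡0)) (≈-reflexive (+-comm (k * ⟦ x ⟧ₚ) ⟦ x ⟧ₚ)))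

  ⟦^·⟧ₚ-of-⟦⟧₄≡0 : ∀ g k x → ⟦ g ⟧₄ ≡ 0 → ⟦ g ^ᴳ k · x ⟧ₚ ≈ k * ⟦ g ⟧ₚ + ⟦ x ⟧ₚ
  ⟦^·⟧ₚ-of-⟦⟧₄≡0 g k x ⟦g⟧₄≡0 =
    ≈-trans (⟦·⟧ₚ-of-⟦⟧₄≡0 x (⟦^⟧₄-of-⟦⟧₄≡0 g k ⟦g⟧₄≡0)) (+-congʳ ⟦ x ⟧ₚ (⟦^⟧ₚ-of-⟦⟧₄≡0 g k ⟦g⟧₄≡0))

  ⟦^·⟧₄-of-⟦⟧₄≡0 : ∀ g k x → ⟦ g ⟧₄ ≡ 0 → ⟦ g ^ᴳ k · x ⟧₄ ≈₄ ⟦ x ⟧₄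
  ⟦^·⟧₄-of-⟦⟧₄≡0 g k x ⟦g⟧₄≡0 =
    ℤ₄.≈-trans (⟦·⟧₄ (g ^ᴳ k) x) (ℤ₄.≈-reflexive (cong (_+ ⟦ x ⟧₄) (⟦^⟧₄-of-⟦⟧₄≡0 g k ⟦g⟧₄≡0)))

  Homomorphic : (G → G) → Set
  Homomorphic α = ∀ x y → α (x · y) ≡ α x · α y

  hom-^ : ∀ α → Homomorphic α → α e ≡ e → ∀ x k → α (x ^ᴳ k) ≡ α x ^ᴳ k
  hom-^ α hom αe≡e x zero    = αe≡e
  hom-^ α hom αe≡e x (suc k) = trans (hom (x ^ᴳ k) x) (cong (_· α x) (hom-^ α hom αe≡e x k))

  module _ (ρ⁴≈1 : ρ ^ 4 ≈ 1) where

    ρ^⟦⟧₄-unit : ∀ x → ρ ^ (4 ∸ ⟦ x ⟧₄) * ρ ^ ⟦ x ⟧₄ ≈ 1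
    ρ^⟦⟧₄-unit x = t^[d∸k]*t^k≈1 ρ⁴≈1 ⟦ x ⟧₄ (⟦⟧₄≤4 x)

    ·-cancelˡ : ∀ g {x y} → g · x ≡ g · y → x ≡ y
    ·-cancelˡ g {x} {y} gx≡gy = ⟦⟧-injective
      (*-cancelˡ-unit (ρ ^ ⟦ g ⟧₄) (ρ ^ (4 ∸ ⟦ g ⟧₄)) (ρ^⟦⟧₄-unit g) (+-cancelˡ ⟦ g ⟧ₚ (begin
        ⟦ g ⟧ₚ + ρ ^ ⟦ g ⟧₄ * ⟦ x ⟧ₚ   ≈⟨ ⟦·⟧ₚ g x ⟨
        ⟦ g · x ⟧ₚ                    ≡⟨ cong ⟦_⟧ₚ gx≡gy ⟩
        ⟦ g · y ⟧ₚ                    ≈⟨ ⟦·⟧ₚ g y ⟩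
        ⟦ g ⟧ₚ + ρ ^ ⟦ g ⟧₄ * ⟦ y ⟧ₚ   ∎)))
      (ℤ₄.+-cancelˡ ⟦ g ⟧₄ (ℤ₄.≈-trans (ℤ₄.≈-sym (⟦·⟧₄ g x))
        (ℤ₄.≈-trans (ℤ₄.≈-reflexive (cong ⟦_⟧₄ gx≡gy)) (⟦·⟧₄ g y))))
      where open ≈-Reasoning

    infixl 7 _\\_
    _\\_ : G → G → G
    g \\ y = mk (ρ ^ (4 ∸ ⟦ g ⟧₄) * (⟦ y ⟧ₚ + neg ⟦ g ⟧ₚ)) (⟦ y ⟧₄ + ℤ₄.neg ⟦ g ⟧₄)

    ·-\\ : ∀ g y → g · (g \\ y) ≡ y
    ·-\\ g y = ⟦⟧-injective
      (begin
        ⟦ g · (g \\ y) ⟧ₚ                                  ≈⟨ ⟦·⟧ₚ g (g \\ y) ⟩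
        ⟦ g ⟧ₚ + ρ ^ ⟦ g ⟧₄ * ⟦ g \\ y ⟧ₚ
          ≈⟨ +-congˡ ⟦ g ⟧ₚ (*-congˡ (ρ ^ ⟦ g ⟧₄) (⟦mk⟧ₚ (ρ ^ (4 ∸ ⟦ g ⟧₄) * d) l)) ⟩
        ⟦ g ⟧ₚ + ρ ^ ⟦ g ⟧₄ * (ρ ^ (4 ∸ ⟦ g ⟧₄) * d)         ≡⟨ regroup ⟦ g ⟧ₚ (ρ ^ ⟦ g ⟧₄) (ρ ^ (4 ∸ ⟦ g ⟧₄)) d ⟩
        ⟦ g ⟧ₚ + ρ ^ (4 ∸ ⟦ g ⟧₄) * ρ ^ ⟦ g ⟧₄ * d           ≈⟨ +-congˡ ⟦ g ⟧ₚ (*-congʳ d (ρ^⟦⟧₄-unit g)) ⟩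
        ⟦ g ⟧ₚ + 1 * (⟦ y ⟧ₚ + neg ⟦ g ⟧ₚ)                   ≡⟨ regroup′ ⟦ g ⟧ₚ ⟦ y ⟧ₚ (neg ⟦ g ⟧ₚ) ⟩
        ⟦ y ⟧ₚ + (⟦ g ⟧ₚ + neg ⟦ g ⟧ₚ)                       ≈⟨ +-congˡ ⟦ y ⟧ₚ (+-inverseʳ ⟦ g ⟧ₚ) ⟩
        ⟦ y ⟧ₚ + 0                                          ≡⟨ +-identityʳ ⟦ y ⟧ₚ ⟩
        ⟦ y ⟧ₚ                                              ∎)
      (ℤ₄.≈-trans (⟦·⟧₄ g (g \\ y)) (ℤ₄.≈-trans (ℤ₄.+-congˡ ⟦ g ⟧₄ (⟦mk⟧₄ (ρ ^ (4 ∸ ⟦ g ⟧₄) * d) l))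
        (ℤ₄.≈-trans (ℤ₄.≈-reflexive (regroup″ ⟦ g ⟧₄ ⟦ y ⟧₄ (ℤ₄.neg ⟦ g ⟧₄)))
        (ℤ₄.≈-trans (ℤ₄.+-congˡ ⟦ y ⟧₄ (ℤ₄.+-inverseʳ ⟦ g ⟧₄)) (ℤ₄.≈-reflexive (+-identityʳ ⟦ y ⟧₄))))))
      where
      open ≈-Reasoning
      d = ⟦ y ⟧ₚ + neg ⟦ g ⟧ₚ
      l = ⟦ y ⟧₄ + ℤ₄.neg ⟦ g ⟧₄
      regroup : ∀ a s t d → a + s * (t * d) ≡ a + t * s * d
      regroup = solve-∀
      regroup′ : ∀ a b c → a + 1 * (b + c) ≡ b + (a + c)
      regroup′ = solve-∀
      regroup″ : ∀ a b c → a + (b + c) ≡ b + (a + c)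
      regroup″ = solve-∀

    translation-bijective : ∀ g → Bijective _≡_ _≡_ (g ·_)
    translation-bijective g = ·-cancelˡ g , strictlySurjective⇒surjective λ y → g \\ y , ·-\\ g y

    hom-e : ∀ α → Homomorphic α → α e ≡ e
    hom-e α hom = ·-cancelˡ (α e) (begin
      α e · α e    ≡⟨ hom e e ⟨
      α (e · e)    ≡⟨ cong α (·-identityʳ e) ⟩
      α e          ≡⟨ ·-identityʳ (α e) ⟨
      α e · e      ∎)
      where open ≡-Reasoning


module ⇔-Reasoning = SetoidReasoning (⇔-setoid 0ℓ)

module ConsecutiveSolutions (p : ℕ) .{{_ : NonZero p}} (ρ : ℕ) (ρ⁴≈1 : Congruence._≈_ p (ρ ^ 4) 1) where

  open Congruence p
  open LinearEquations p
  open SemidirectProduct p ρ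
  open ℤ₄ using () renaming (_≈_ to _≈₄_)

  Consecutive : G → G → G → Set
  Consecutive x y z = ⟦ y ⟧₄ ≈₄ ⟦ x ⟧₄ + 1 × ⟦ z ⟧₄ ≈₄ ⟦ x ⟧₄ + 2

  SolutionTriple : LinearEquation → G → G → G → Set
  SolutionTriple E x y z = Consecutive x y z × Solves E ⟦ x ⟧ₚ ⟦ y ⟧ₚ ⟦ z ⟧ₚ

  solutionTriple? : ∀ E x y z → Dec (SolutionTriple E x y z)
  solutionTriple? E x y z =
    (⟦ y ⟧₄ ℤ₄.≈? ⟦ x ⟧₄ + 1 ×-dec ⟦ z ⟧₄ ℤ₄.≈? ⟦ x ⟧₄ + 2) ×-dec solves? E ⟦ x ⟧ₚ ⟦ y ⟧ₚ ⟦ z ⟧ₚ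

  solutions : LinearEquation → Rel3 G
  solutions E = decRel3 (solutionTriple? E)

  ⟦⟧₄-offset-translate : ∀ g {x y} k → ⟦ y ⟧₄ ≈₄ ⟦ x ⟧₄ + k ⇔ ⟦ g · y ⟧₄ ≈₄ ⟦ g · x ⟧₄ + k
  ⟦⟧₄-offset-translate g {x} {y} k = mk⇔
    (λ y≈x+k → begin
      ⟦ g · y ⟧₄              ≈⟨ ⟦·⟧₄ g y ⟩
      ⟦ g ⟧₄ + ⟦ y ⟧₄          ≈⟨ ℤ₄.+-congˡ ⟦ g ⟧₄ y≈x+k ⟩
      ⟦ g ⟧₄ + (⟦ x ⟧₄ + k)    ≡⟨ +-assoc ⟦ g ⟧₄ ⟦ x ⟧₄ k ⟨
      ⟦ g ⟧₄ + ⟦ x ⟧₄ + k      ≈⟨ ℤ₄.+-congʳ k (⟦·⟧₄ g x) ⟨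
      ⟦ g · x ⟧₄ + k          ∎)
    (λ gy≈gx+k → ℤ₄.+-cancelˡ ⟦ g ⟧₄ (begin
      ⟦ g ⟧₄ + ⟦ y ⟧₄          ≈⟨ ⟦·⟧₄ g y ⟨
      ⟦ g · y ⟧₄              ≈⟨ gy≈gx+k ⟩
      ⟦ g · x ⟧₄ + k          ≈⟨ ℤ₄.+-congʳ k (⟦·⟧₄ g x) ⟩
      ⟦ g ⟧₄ + ⟦ x ⟧₄ + k      ≡⟨ +-assoc ⟦ g ⟧₄ ⟦ x ⟧₄ k ⟩
      ⟦ g ⟧₄ + (⟦ x ⟧₄ + k)    ∎))
    where open ℤ₄.≈-Reasoning

  solves-left-translate : ∀ E → Balanced E → ∀ g {x y z} →
    Solves E ⟦ x ⟧ₚ ⟦ y ⟧ₚ ⟦ z ⟧ₚ ⇔ Solves E ⟦ g · x ⟧ₚ ⟦ g · y ⟧ₚ ⟦ g · z ⟧ₚ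
  solves-left-translate E bal g {x} {y} {z} = begin
    Solves E ⟦ x ⟧ₚ ⟦ y ⟧ₚ ⟦ z ⟧ₚ                     ≈⟨ solves-scale E t (ρ ^ (4 ∸ ⟦ g ⟧₄)) (ρ^⟦⟧₄-unit ρ⁴≈1 g) ⟩
    Solves E (t * ⟦ x ⟧ₚ) (t * ⟦ y ⟧ₚ) (t * ⟦ z ⟧ₚ)    ≈⟨ solves-translate E ⟦ g ⟧ₚ bal ⟩
    Solves E (⟦ g ⟧ₚ + t * ⟦ x ⟧ₚ) (⟦ g ⟧ₚ + t * ⟦ y ⟧ₚ) (⟦ g ⟧ₚ + t * ⟦ z ⟧ₚ)
      ≈⟨ solves-⇔-resp-≈ E (≈-sym (⟦·⟧ₚ g x)) (≈-sym (⟦·⟧ₚ g y)) (≈-sym (⟦·⟧ₚ g z)) ⟩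
    Solves E ⟦ g · x ⟧ₚ ⟦ g · y ⟧ₚ ⟦ g · z ⟧ₚ         ∎
    where
    open ⇔-Reasoning
    t = ρ ^ ⟦ g ⟧₄

  solution-left-translate : ∀ E → Balanced E → ∀ g x y z →
    SolutionTriple E x y z ⇔ SolutionTriple E (g · x) (g · y) (g · z)
  solution-left-translate E bal g x y z =
    (⟦⟧₄-offset-translate g {x} {y} 1 ×-⇔ ⟦⟧₄-offset-translate g {x} {z} 2)
      ×-⇔ solves-left-translate E bal g {x} {y} {z}

  solutions-cayley : ∀ E → Balanced E → IsCayley _·_ (solutions E ∷ [])
  solutions-cayley E bal g = isIso-singleton (translation-bijective ρ⁴≈1 g)
    (mapsTo-of-⇔ (solutionTriple? E) (solutionTriple? E) (g ·_) (solution-left-translate E bal g))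

  module Twisting (r : ℕ) (r⁴≈1 : r ^ 4 ≈ 1) where

    μ : G → G
    μ (a , b) = (r ^ toℕ b * toℕ a) mod p , b

    μ⁻¹ : G → G
    μ⁻¹ (a , b) = (r ^ (4 ∸ toℕ b) * toℕ a) mod p , b

    ⟦μ⟧ₚ : ∀ x → ⟦ μ x ⟧ₚ ≈ r ^ ⟦ x ⟧₄ * ⟦ x ⟧ₚ
    ⟦μ⟧ₚ x = ≈-trans (≈-reflexive (toℕ-mod _ p)) (%-≈ _)

    r^⟦⟧₄-unit : ∀ x → r ^ (4 ∸ ⟦ x ⟧₄) * r ^ ⟦ x ⟧₄ ≈ 1
    r^⟦⟧₄-unit x = t^[d∸k]*t^k≈1 r⁴≈1 ⟦ x ⟧₄ (⟦⟧₄≤4 x)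

    μ-μ⁻¹ : ∀ y → μ (μ⁻¹ y) ≡ y
    μ-μ⁻¹ y = ⟦⟧-injective (begin
      ⟦ μ (μ⁻¹ y) ⟧ₚ                          ≈⟨ ⟦μ⟧ₚ (μ⁻¹ y) ⟩
      r ^ ⟦ y ⟧₄ * ⟦ μ⁻¹ y ⟧ₚ                  ≈⟨ *-congˡ (r ^ ⟦ y ⟧₄) (≈-trans (≈-reflexive (toℕ-mod _ p)) (%-≈ _)) ⟩
      r ^ ⟦ y ⟧₄ * (r ^ (4 ∸ ⟦ y ⟧₄) * ⟦ y ⟧ₚ)   ≡⟨ swap (r ^ ⟦ y ⟧₄) (r ^ (4 ∸ ⟦ y ⟧₄)) ⟦ y ⟧ₚ ⟩
      r ^ (4 ∸ ⟦ y ⟧₄) * r ^ ⟦ y ⟧₄ * ⟦ y ⟧ₚ     ≈⟨ *-congʳ ⟦ y ⟧ₚ (r^⟦⟧₄-unit y) ⟩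
      1 * ⟦ y ⟧ₚ                               ≡⟨ *-identityˡ ⟦ y ⟧ₚ ⟩
      ⟦ y ⟧ₚ                                   ∎) ℤ₄.≈-refl
      where
      open ≈-Reasoning
      swap : ∀ a b c → a * (b * c) ≡ b * a * c
      swap = solve-∀

    μ-injective : ∀ {x y} → μ x ≡ μ y → x ≡ y
    μ-injective {x} {y} μx≡μy = ⟦⟧-injective
      (*-cancelˡ-unit (r ^ ⟦ x ⟧₄) (r ^ (4 ∸ ⟦ x ⟧₄)) (r^⟦⟧₄-unit x) (begin
        r ^ ⟦ x ⟧₄ * ⟦ x ⟧ₚ   ≈⟨ ⟦μ⟧ₚ x ⟨
        ⟦ μ x ⟧ₚ             ≡⟨ cong ⟦_⟧ₚ μx≡μy ⟩
        ⟦ μ y ⟧ₚ             ≈⟨ ⟦μ⟧ₚ y ⟩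
        r ^ ⟦ y ⟧₄ * ⟦ y ⟧ₚ   ≡⟨ cong (λ k → r ^ k * ⟦ y ⟧ₚ) ⟦x⟧₄≡⟦y⟧₄ ⟨
        r ^ ⟦ x ⟧₄ * ⟦ y ⟧ₚ   ∎))
      (ℤ₄.≈-reflexive ⟦x⟧₄≡⟦y⟧₄)
      where
      open ≈-Reasoning
      ⟦x⟧₄≡⟦y⟧₄ = cong ⟦_⟧₄ μx≡μy

    μ-bijective : Bijective _≡_ _≡_ μ
    μ-bijective = μ-injective , strictlySurjective⇒surjective λ y → μ⁻¹ y , μ-μ⁻¹ y

    r^-resp-≈₄ : ∀ {k l} → k ≈₄ l → r ^ k ≈ r ^ l
    r^-resp-≈₄ {k} {l} k≈l = begin
      r ^ k          ≈⟨ t^[k%d]≈t^k r⁴≈1 k ⟨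
      r ^ (k % 4)    ≡⟨ cong (r ^_) (ℤ₄.%-≡ k≈l) ⟩
      r ^ (l % 4)    ≈⟨ t^[k%d]≈t^k r⁴≈1 l ⟩
      r ^ l          ∎
      where open ≈-Reasoning

    ⟦μ⟧ₚ-offset : ∀ {x y} k → ⟦ y ⟧₄ ≈₄ ⟦ x ⟧₄ + k → ⟦ μ y ⟧ₚ ≈ r ^ ⟦ x ⟧₄ * (r ^ k * ⟦ y ⟧ₚ)
    ⟦μ⟧ₚ-offset {x} {y} k y≈x+k = begin
      ⟦ μ y ⟧ₚ                        ≈⟨ ⟦μ⟧ₚ y ⟩
      r ^ ⟦ y ⟧₄ * ⟦ y ⟧ₚ              ≈⟨ *-congʳ ⟦ y ⟧ₚ (r^-resp-≈₄ y≈x+k) ⟩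
      r ^ (⟦ x ⟧₄ + k) * ⟦ y ⟧ₚ        ≡⟨ cong (_* ⟦ y ⟧ₚ) (^-distribˡ-+-* r ⟦ x ⟧₄ k) ⟩
      r ^ ⟦ x ⟧₄ * r ^ k * ⟦ y ⟧ₚ      ≡⟨ *-assoc (r ^ ⟦ x ⟧₄) (r ^ k) ⟦ y ⟧ₚ ⟩
      r ^ ⟦ x ⟧₄ * (r ^ k * ⟦ y ⟧ₚ)    ∎
      where open ≈-Reasoning

    solves-twist-μ : ∀ E {x y z} → Consecutive x y z →
      Solves (twist r E) ⟦ x ⟧ₚ ⟦ y ⟧ₚ ⟦ z ⟧ₚ ⇔ Solves E ⟦ μ x ⟧ₚ ⟦ μ y ⟧ₚ ⟦ μ z ⟧ₚ
    solves-twist-μ E {x} {y} {z} (y≈x+1 , z≈x+2) = begin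
      Solves (twist r E) X Y Z                          ≈⟨ solves-twist E r {X} {Y} {Z} ⟩
      Solves E X (r * Y) (r * r * Z)                    ≈⟨ solves-scale E t (r ^ (4 ∸ ⟦ x ⟧₄)) {X} (r^⟦⟧₄-unit x) ⟩
      Solves E (t * X) (t * (r * Y)) (t * (r * r * Z))  ≈⟨ solves-⇔-resp-≈ E (⟦μ⟧ₚ x) ⟦μy⟧ₚ ⟦μz⟧ₚ ⟨
      Solves E ⟦ μ x ⟧ₚ ⟦ μ y ⟧ₚ ⟦ μ z ⟧ₚ                 ∎
      where
      open ⇔-Reasoning
      X = ⟦ x ⟧ₚ
      Y = ⟦ y ⟧ₚ
      Z = ⟦ z ⟧ₚ
      t = r ^ ⟦ x ⟧₄
      ⟦μy⟧ₚ : ⟦ μ y ⟧ₚ ≈ t * (r * Y)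
      ⟦μy⟧ₚ = ≈-trans (⟦μ⟧ₚ-offset {x} {y} 1 y≈x+1) (≈-reflexive (cong (λ s → t * (s * Y)) (*-identityʳ r)))
      ⟦μz⟧ₚ : ⟦ μ z ⟧ₚ ≈ t * (r * r * Z)
      ⟦μz⟧ₚ = ≈-trans (⟦μ⟧ₚ-offset {x} {z} 2 z≈x+2) (≈-reflexive (cong (λ s → t * (r * s * Z)) (*-identityʳ r)))

    solution-twist : ∀ E x y z → SolutionTriple (twist r E) x y z ⇔ SolutionTriple E (μ x) (μ y) (μ z)
    solution-twist E x y z = mk⇔
      (λ (cons , sol) → cons , Equivalence.to (solves-twist-μ E cons) sol)
      (λ (cons , sol) → cons , Equivalence.from (solves-twist-μ E cons) sol)

    μ-isIso : ∀ E → IsIso μ (solutions (twist r E) ∷ []) (solutions E ∷ [])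
    μ-isIso E = isIso-singleton μ-bijective
      (mapsTo-of-⇔ (solutionTriple? (twist r E)) (solutionTriple? E) μ (solution-twist E))


module NotCI3 {p : ℕ} .{{_ : NonZero p}} (prime : Prime p) (p%4≡1 : p % 4 ≡ 1)
             (ρ : ℕ) (ρ⁴≈1 : Congruence._≈_ p (ρ ^ 4) 1)
             (r : ℕ) (r²+1≈0 : Congruence._≈_ p (r * r + 1) 0) where

  open Congruence p
  open LinearEquations p
  open SemidirectProduct p ρ
  open ℤ₄ using () renaming (_≈_ to _≈₄_)
  open ConsecutiveSolutions p ρ ρ⁴≈1
  open Twisting r (t²+1≈0⇒t⁴≈1 r r²+1≈0)
  open PrimeModulus prime using (euclidsLemma-≈; 1<p)

  E : LinearEquation
  E = ⟨ 0 , 2 , r ⟩ ≐ ⟨ 1 + r , 0 , 1 ⟩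

  E-balanced : Balanced E
  E-balanced = ≈-reflexive (lemma r)
    where
    lemma : ∀ r → 0 + 2 + r ≡ 1 + r + 0 + 1
    lemma = solve-∀

  twist-E-balanced : Balanced (twist r E)
  twist-E-balanced = begin
    0 + r * 2 + r * r * r     ≡⟨ lemma₁ r ⟩
    r + r * (r * r + 1)       ≈⟨ +-congˡ r (*-congˡ r r²+1≈0) ⟩
    r + r * 0                 ≡⟨ lemma₂ r ⟩
    r + 0                     ≈⟨ +-congˡ r r²+1≈0 ⟨
    r + (r * r + 1)           ≡⟨ lemma₃ r ⟩
    1 + r + r * 0 + r * r * 1 ∎
    where
    open ≈-Reasoning
    lemma₁ : ∀ r → 0 + r * 2 + r * r * r ≡ r + r * (r * r + 1)
    lemma₁ = solve-∀
    lemma₂ : ∀ r → r + r * 0 ≡ r + 0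
    lemma₂ = solve-∀
    lemma₃ : ∀ r → r + (r * r + 1) ≡ 1 + r + r * 0 + r * r * 1
    lemma₃ = solve-∀

  t s : G
  t = mk 1 0
  s = mk 0 1

  tᵖ≡e : t ^ᴳ p ≡ e
  tᵖ≡e = ⟦⟧-injective
    (begin
      ⟦ t ^ᴳ p ⟧ₚ   ≈⟨ ⟦^⟧ₚ-of-⟦⟧₄≡0 t p refl ⟩
      p * ⟦ t ⟧ₚ    ≈⟨ *-congˡ p (⟦mk⟧ₚ 1 0) ⟩
      p * 1         ≡⟨ *-identityʳ p ⟩
      p             ≈⟨ m≈0 ⟩
      0             ≡⟨ ⟦e⟧ₚ ⟨
      ⟦ e ⟧ₚ        ∎)
    (ℤ₄.≈-reflexive (⟦^⟧₄-of-⟦⟧₄≡0 t p refl))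
    where open ≈-Reasoning

  module _ {α : G → G} (hom : Homomorphic α) (α-injective : Injective _≡_ _≡_ α)
           (maps : MapsTo α (solutions (twist r E)) (solutions E)) where

    αe≡e : α e ≡ e
    αe≡e = hom-e ρ⁴≈1 α hom

    ⟦αt⟧₄≡0 : ⟦ α t ⟧₄ ≡ 0
    ⟦αt⟧₄≡0 = ℤ₄.≈∧<⇒≡ (toℕ<n (proj₂ (α t))) (s≤s z≤n) (begin
      ⟦ α t ⟧₄            ≡⟨ *-identityˡ ⟦ α t ⟧₄ ⟨
      1 * ⟦ α t ⟧₄        ≈⟨ ℤ₄.*-congʳ ⟦ α t ⟧₄ (ℤ₄.mk≈ {p} {1} p%4≡1) ⟨
      p * ⟦ α t ⟧₄        ≈⟨ ⟦^⟧₄ (α t) p ⟨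
      ⟦ α t ^ᴳ p ⟧₄       ≡⟨ cong ⟦_⟧₄ (hom-^ α hom αe≡e t p) ⟨
      ⟦ α (t ^ᴳ p) ⟧₄     ≡⟨ cong (λ x → ⟦ α x ⟧₄) tᵖ≡e ⟩
      ⟦ α e ⟧₄            ≡⟨ cong ⟦_⟧₄ αe≡e ⟩
      0                   ∎)
      where open ℤ₄.≈-Reasoning

    u c C : ℕ
    u = ⟦ α t ⟧ₚ
    c = ⟦ α s ⟧ₚ
    C = ⟦ α s · α s ⟧ₚ

    u≉0 : ¬ u ≈ 0
    u≉0 u≈0 = 1≉0 1<p (begin
      1           ≈⟨ ⟦mk⟧ₚ 1 0 ⟨
      ⟦ t ⟧ₚ      ≡⟨ cong ⟦_⟧ₚ (α-injective (trans αt≡e (sym αe≡e))) ⟩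
      ⟦ e ⟧ₚ      ≡⟨ ⟦e⟧ₚ ⟩
      0           ∎)
      where
      open ≈-Reasoning
      αt≡e : α t ≡ e
      αt≡e = ⟦⟧-injective (≈-trans u≈0 (≈-reflexive (sym ⟦e⟧ₚ))) (ℤ₄.≈-reflexive ⟦αt⟧₄≡0)

    -- α sends the triple (e, tᵏ·s, tˡ·(s·s)) to (e, (α t)ᵏ·α s, (α t)ˡ·(α s·α s)).
    image-solves : ∀ k l → Solves (twist r E) 0 k l → Solves E 0 (k * u + c) (l * u + C)
    image-solves k l sol = solves-resp-≈ E
      (≈-reflexive (trans (cong ⟦_⟧ₚ αe≡e) ⟦e⟧ₚ))
      (≈-trans (≈-reflexive (cong ⟦_⟧ₚ (α[tᵏ·x] k s))) (⟦^·⟧ₚ-of-⟦⟧₄≡0 (α t) k (α s) ⟦αt⟧₄≡0))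
      (≈-trans (≈-reflexive (cong ⟦_⟧ₚ (trans (α[tᵏ·x] l (s · s)) (cong (α t ^ᴳ l ·_) (hom s s)))))
               (⟦^·⟧ₚ-of-⟦⟧₄≡0 (α t) l (α s · α s) ⟦αt⟧₄≡0))
      (proj₂ (mapsTo-preserves (solutionTriple? (twist r E)) (solutionTriple? E) {α} maps triple))
      where
      α[tᵏ·x] : ∀ k x → α (t ^ᴳ k · x) ≡ α t ^ᴳ k · α x
      α[tᵏ·x] k x = trans (hom (t ^ᴳ k) x) (cong (_· α x) (hom-^ α hom αe≡e t k))
      ⟦tᵏ·x⟧ₚ : ∀ k x → ⟦ t ^ᴳ k · x ⟧ₚ ≈ k + ⟦ x ⟧ₚ
      ⟦tᵏ·x⟧ₚ k x = ≈-trans (⟦^·⟧ₚ-of-⟦⟧₄≡0 t k x refl)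
        (+-congʳ ⟦ x ⟧ₚ (≈-trans (*-congˡ k (⟦mk⟧ₚ 1 0)) (≈-reflexive (*-identityʳ k))))
      ⟦s·s⟧ₚ : ⟦ s · s ⟧ₚ ≈ 0
      ⟦s·s⟧ₚ = ≈-trans (⟦·⟧ₚ s s) (≈-reflexive (trans (cong (λ z → z + ρ ^ 1 * z) (⟦mk0⟧ₚ 1)) (*-zeroʳ (ρ ^ 1))))
      triple : SolutionTriple (twist r E) e (t ^ᴳ k · s) (t ^ᴳ l · (s · s))
      triple = (⟦^·⟧₄-of-⟦⟧₄≡0 t k s refl , ℤ₄.≈-trans (⟦^·⟧₄-of-⟦⟧₄≡0 t l (s · s) refl) (⟦·⟧₄ s s)) ,
        solves-resp-≈ (twist r E) (≈-reflexive (sym ⟦e⟧ₚ))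
          (≈-sym (≈-trans (⟦tᵏ·x⟧ₚ k s) (≈-reflexive (trans (cong (k +_) (⟦mk0⟧ₚ 1)) (+-identityʳ k)))))
          (≈-sym (≈-trans (⟦tᵏ·x⟧ₚ l (s · s)) (≈-trans (+-congˡ l ⟦s·s⟧ₚ) (≈-reflexive (+-identityʳ l)))))
          sol

    C≈2c+rC : C ≈ 2 * c + r * C
    C≈2c+rC = begin
      C                                  ≡⟨ lemma r c C ⟩
      (1 + r) * 0 + 0 * c + 1 * C        ≈⟨ image-solves 0 0 (solves-zero (twist r E)) ⟨
      0 * 0 + 2 * c + r * C              ≡⟨⟩
      2 * c + r * C                      ∎
      where
      open ≈-Reasoning
      lemma : ∀ r c C → C ≡ (1 + r) * 0 + 0 * c + 1 * C
      lemma = solve-∀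

    twist-E-solution : Solves (twist r E) 0 (1 + r) 2
    twist-E-solution = begin
      0 * 0 + r * 2 * (1 + r) + r * r * r * 2     ≡⟨ lemma₁ r ⟩
      r * r * 2 + 2 * r * (r * r + 1)             ≈⟨ +-congˡ (r * r * 2) (*-congˡ (2 * r) r²+1≈0) ⟩
      r * r * 2 + 2 * r * 0                       ≡⟨ lemma₂ r ⟩
      (1 + r) * 0 + r * 0 * (1 + r) + r * r * 1 * 2 ∎
      where
      open ≈-Reasoning
      lemma₁ : ∀ r → 0 * 0 + r * 2 * (1 + r) + r * r * r * 2 ≡ r * r * 2 + 2 * r * (r * r + 1)
      lemma₁ = solve-∀
      lemma₂ : ∀ r → r * r * 2 + 2 * r * 0 ≡ (1 + r) * 0 + r * 0 * (1 + r) + r * r * 1 * 2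
      lemma₂ = solve-∀

    4ru≈0 : 4 * (r * u) ≈ 0
    4ru≈0 = +-cancelʳ (2 * u + C) (begin
      4 * (r * u) + (2 * u + C)                               ≈⟨ +-congˡ (4 * (r * u)) (+-congˡ (2 * u) C≈2c+rC) ⟩
      4 * (r * u) + (2 * u + (2 * c + r * C))                 ≡⟨ lemma₁ r u c C ⟩
      0 * 0 + 2 * ((1 + r) * u + c) + r * (2 * u + C)         ≈⟨ image-solves (1 + r) 2 twist-E-solution ⟩
      (1 + r) * 0 + 0 * ((1 + r) * u + c) + 1 * (2 * u + C)   ≡⟨ lemma₂ r u c C ⟩
      0 + (2 * u + C)                                         ∎)
      where
      open ≈-Reasoning
      lemma₁ : ∀ r u c C → 4 * (r * u) + (2 * u + (2 * c + r * C)) ≡ 0 * 0 + 2 * ((1 + r) * u + c) + r * (2 * u + C)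
      lemma₁ = solve-∀
      lemma₂ : ∀ r u c C → (1 + r) * 0 + 0 * ((1 + r) * u + c) + 1 * (2 * u + C) ≡ 0 + (2 * u + C)
      lemma₂ = solve-∀

    absurd : ⊥
    absurd = [ 4≉0 , [ r≉0 , u≉0 ]′ ∘ euclidsLemma-≈ r u ]′ (euclidsLemma-≈ 4 (r * u) 4ru≈0)
      where
      4≉0 : ¬ 4 ≈ 0
      4≉0 4≈0 = ¬prime[1] (subst Prime (%4≡1∧∣4⇒≡1 p%4≡1 (≈0⇒∣ 4≈0)) prime)
      r≉0 : ¬ r ≈ 0
      r≉0 r≈0 = 1≉0 1<p (≈-trans (≈-sym (+-congʳ 1 (*-congʳ r r≈0))) r²+1≈0)

  no-automorphism : ¬ ∃ λ α → IsGroupAut _·_ α × IsIso α (solutions (twist r E) ∷ []) (solutions E ∷ [])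
  no-automorphism (α , (α-bijective , hom) , α-iso) = absurd hom (proj₁ α-bijective) (isIso-singleton⁻ α-iso)

  ¬IsCI3 : ¬ IsCI3 G _·_
  ¬IsCI3 ci = no-automorphism (ci _ _ (solutions-cayley (twist r E) twist-E-balanced)
                                     (solutions-cayley E E-balanced) (μ , μ-isIso E))


-- The cyclic group ℤ₄ₚ ≅ ℤₚ × ℤ₄

module CyclicGroupDecomposition (p : ℕ) .{{_ : NonZero p}} (p%4≡1 : p % 4 ≡ 1) where

  open Congruence p
  open SemidirectProduct p 1
  open ℤ₄ using () renaming (_≈_ to _≈₄_)

  instance
    4p≢0 : NonZero (4 * p)
    4p≢0 = m*n≢0 4 p

  p≈₄1 : p ≈₄ 1
  p≈₄1 = ℤ₄.mk≈ p%4≡1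

  %4p-≈ : ∀ n → n % (4 * p) ≈ n
  %4p-≈ n = mk≈ (m∣n⇒o%n%m≡o%m p (4 * p) n (n∣m*n 4))

  %4p-≈₄ : ∀ n → n % (4 * p) ≈₄ n
  %4p-≈₄ n = ℤ₄.mk≈ (m∣n⇒o%n%m≡o%m 4 (4 * p) n (m∣m*n p))

  ψ : Fin (4 * p) → G
  ψ x = mk (toℕ x) (toℕ x)

  ⟦ψ⟧ₚ : ∀ x → ⟦ ψ x ⟧ₚ ≈ toℕ x
  ⟦ψ⟧ₚ x = ⟦mk⟧ₚ (toℕ x) (toℕ x)

  ⟦ψ⟧₄ : ∀ x → ⟦ ψ x ⟧₄ ≈₄ toℕ x
  ⟦ψ⟧₄ x = ⟦mk⟧₄ (toℕ x) (toℕ x)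

  -- 3p + 1 and p are the idempotents of ℤ₄ₚ ≅ ℤₚ × ℤ₄ since p ≡ 1 (mod 4)
  ψ⁻¹ : G → Fin (4 * p)
  ψ⁻¹ x = ((3 * p + 1) * ⟦ x ⟧ₚ + p * ⟦ x ⟧₄) mod (4 * p)

  idempotentₚ : ∀ a b → (3 * p + 1) * a + p * b ≈ a
  idempotentₚ a b = begin
    (3 * p + 1) * a + p * b    ≈⟨ +-cong (*-congʳ a (+-congʳ 1 (*-congˡ 3 m≈0))) (*-congʳ b m≈0) ⟩
    (3 * 0 + 1) * a + 0 * b    ≡⟨ lemma a b ⟩
    a                          ∎
    where
    open ≈-Reasoning
    lemma : ∀ a b → (3 * 0 + 1) * a + 0 * b ≡ a
    lemma = solve-∀

  idempotent₄ : ∀ a b → (3 * p + 1) * a + p * b ≈₄ b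
  idempotent₄ a b = begin
    (3 * p + 1) * a + p * b    ≈⟨ ℤ₄.+-cong (ℤ₄.*-congʳ a (ℤ₄.+-congʳ 1 (ℤ₄.*-congˡ 3 p≈₄1))) (ℤ₄.*-congʳ b p≈₄1) ⟩
    4 * a + 1 * b              ≈⟨ ℤ₄.+-congʳ (1 * b) (ℤ₄.*-congʳ a ℤ₄.m≈0) ⟩
    0 * a + 1 * b              ≡⟨ lemma a b ⟩
    b                          ∎
    where
    open ℤ₄.≈-Reasoning
    lemma : ∀ a b → 0 * a + 1 * b ≡ b
    lemma = solve-∀

  ψ∘ψ⁻¹ : ∀ x → ψ (ψ⁻¹ x) ≡ x
  ψ∘ψ⁻¹ x = ⟦⟧-injective
    (≈-trans (⟦ψ⟧ₚ (ψ⁻¹ x))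
      (≈-trans (≈-reflexive (toℕ-mod w (4 * p))) (≈-trans (%4p-≈ w) (idempotentₚ ⟦ x ⟧ₚ ⟦ x ⟧₄))))
    (ℤ₄.≈-trans (⟦ψ⟧₄ (ψ⁻¹ x))
      (ℤ₄.≈-trans (ℤ₄.≈-reflexive (toℕ-mod w (4 * p))) (ℤ₄.≈-trans (%4p-≈₄ w) (idempotent₄ ⟦ x ⟧ₚ ⟦ x ⟧₄))))
    where w = (3 * p + 1) * ⟦ x ⟧ₚ + p * ⟦ x ⟧₄

  ≈∧≈₄⇒≡ : ∀ {x y} → x ≤ y → y < 4 * p → x ≈ y → x ≈₄ y → x ≡ y
  ≈∧≈₄⇒≡ {x} {y} x≤y y<4p x≈y x≈₄y with ≈⇒∣∸ x≤y x≈y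
  ... | divides k y∸x≡kp = begin
    x                ≡⟨ +-identityʳ x ⟨
    x + 0 * p        ≡⟨ cong (λ j → x + j * p) k≡0 ⟨
    x + k * p        ≡⟨ cong (x +_) y∸x≡kp ⟨
    x + (y ∸ x)      ≡⟨ m+[n∸m]≡n x≤y ⟩
    y                ∎
    where
    open ≡-Reasoning
    k<4 : k < 4
    k<4 = *-cancelʳ-< p k 4 (subst (_< 4 * p) y∸x≡kp (≤-<-trans (m∸n≤m y x) y<4p))
    k≈₄0 : k ≈₄ 0
    k≈₄0 = ℤ₄.≈-trans (ℤ₄.≈-reflexive (sym (*-identityʳ k)))
      (ℤ₄.≈-trans (ℤ₄.*-congˡ k (ℤ₄.≈-sym p≈₄1))
      (ℤ₄.≈-trans (ℤ₄.≈-reflexive (sym y∸x≡kp)) (ℤ₄.∣⇒≈0 (ℤ₄.≈⇒∣∸ x≤y x≈₄y))))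
    k≡0 : k ≡ 0
    k≡0 = ℤ₄.≈∧<⇒≡ k<4 (s≤s z≤n) k≈₄0

  ψ-injective : ∀ {x y} → ψ x ≡ ψ y → x ≡ y
  ψ-injective {x} {y} ψx≡ψy = toℕ-injective ([ (λ x≤y → ≈∧≈₄⇒≡ x≤y (toℕ<n y) x≈y x≈₄y)
                                               , (λ y≤x → sym (≈∧≈₄⇒≡ y≤x (toℕ<n x) (≈-sym x≈y) (ℤ₄.≈-sym x≈₄y)))
                                               ]′ (≤-total (toℕ x) (toℕ y)))
    where
    x≈y : toℕ x ≈ toℕ y
    x≈y = ≈-trans (≈-sym (⟦ψ⟧ₚ x)) (≈-trans (≈-reflexive (cong ⟦_⟧ₚ ψx≡ψy)) (⟦ψ⟧ₚ y))
    x≈₄y : toℕ x ≈₄ toℕ y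
    x≈₄y = ℤ₄.≈-trans (ℤ₄.≈-sym (⟦ψ⟧₄ x)) (ℤ₄.≈-trans (ℤ₄.≈-reflexive (cong ⟦_⟧₄ ψx≡ψy)) (⟦ψ⟧₄ y))

  ψ⁻¹∘ψ : ∀ x → ψ⁻¹ (ψ x) ≡ x
  ψ⁻¹∘ψ x = ψ-injective (ψ∘ψ⁻¹ (ψ x))

  ψ-hom : ∀ x y → ψ (addMod x y) ≡ ψ x · ψ y
  ψ-hom x y = ⟦⟧-injective ⟦ψ-hom⟧ₚ ⟦ψ-hom⟧₄
    where
    ⟦ψ-hom⟧ₚ : ⟦ ψ (addMod x y) ⟧ₚ ≈ ⟦ ψ x · ψ y ⟧ₚ
    ⟦ψ-hom⟧ₚ = begin
      ⟦ ψ (addMod x y) ⟧ₚ                 ≈⟨ ⟦ψ⟧ₚ (addMod x y) ⟩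
      toℕ (addMod x y)                    ≡⟨ toℕ-addMod x y ⟩
      (toℕ x + toℕ y) % (4 * p)           ≈⟨ %4p-≈ (toℕ x + toℕ y) ⟩
      toℕ x + toℕ y                       ≈⟨ +-cong (⟦ψ⟧ₚ x) (⟦ψ⟧ₚ y) ⟨
      ⟦ ψ x ⟧ₚ + ⟦ ψ y ⟧ₚ                  ≡⟨ cong (⟦ ψ x ⟧ₚ +_) (*-identityˡ ⟦ ψ y ⟧ₚ) ⟨
      ⟦ ψ x ⟧ₚ + 1 * ⟦ ψ y ⟧ₚ              ≡⟨ cong (λ c → ⟦ ψ x ⟧ₚ + c * ⟦ ψ y ⟧ₚ) (^-zeroˡ ⟦ ψ x ⟧₄) ⟨
      ⟦ ψ x ⟧ₚ + 1 ^ ⟦ ψ x ⟧₄ * ⟦ ψ y ⟧ₚ    ≈⟨ ⟦·⟧ₚ (ψ x) (ψ y) ⟨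
      ⟦ ψ x · ψ y ⟧ₚ                       ∎
      where open ≈-Reasoning
    ⟦ψ-hom⟧₄ : ⟦ ψ (addMod x y) ⟧₄ ≈₄ ⟦ ψ x · ψ y ⟧₄
    ⟦ψ-hom⟧₄ = begin
      ⟦ ψ (addMod x y) ⟧₄                 ≈⟨ ⟦ψ⟧₄ (addMod x y) ⟩
      toℕ (addMod x y)                    ≡⟨ toℕ-addMod x y ⟩
      (toℕ x + toℕ y) % (4 * p)           ≈⟨ %4p-≈₄ (toℕ x + toℕ y) ⟩
      toℕ x + toℕ y                       ≈⟨ ℤ₄.+-cong (⟦ψ⟧₄ x) (⟦ψ⟧₄ y) ⟨
      ⟦ ψ x ⟧₄ + ⟦ ψ y ⟧₄                  ≈⟨ ⟦·⟧₄ (ψ x) (ψ y) ⟨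
      ⟦ ψ x · ψ y ⟧₄                       ∎
      where open ℤ₄.≈-Reasoning


corollary7p5 : ∀ (p : ℕ) → Prime p → 5 < p → p % 4 ≡ 1 →
    ¬ IsCI3 (Fin (4 * p)) addMod
    × (∀ (r : ℕ) → p ∣ r * r + 1 → ¬ IsCI3 (Fin p × Fin 4) (sdOp r))
    × ¬ IsCI3 (Fin p × Fin 4) (sdOp (p ∸ 1))
corollary7p5 p p-prime _ p%4≡1 = cyclic , frobenius , dicyclic
  where
  instance
    p≢0 : NonZero p
    p≢0 = prime⇒nonZero p-prime

  open Congruence p

  square-root-of-minus-one : ∃ λ r → r * r + 1 ≈ 0
  square-root-of-minus-one = PrimeModulus.-1-is-square p-prime p%4≡1

  semidirect-¬CI3 : ∀ ρ → ρ ^ 4 ≈ 1 → ¬ IsCI3 (Fin p × Fin 4) (sdOp ρ)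
  semidirect-¬CI3 ρ ρ⁴≈1 =
    NotCI3.¬IsCI3 p-prime p%4≡1 ρ ρ⁴≈1 (proj₁ square-root-of-minus-one) (proj₂ square-root-of-minus-one)

  cyclic : ¬ IsCI3 (Fin (4 * p)) addMod
  cyclic = semidirect-¬CI3 1 ≈-refl ∘ Transport.isCI3-transport ψ ψ⁻¹ ψ⁻¹∘ψ ψ∘ψ⁻¹ ψ-hom
    where open CyclicGroupDecomposition p p%4≡1

  frobenius : ∀ r → p ∣ r * r + 1 → ¬ IsCI3 (Fin p × Fin 4) (sdOp r)
  frobenius r p∣r²+1 = NotCI3.¬IsCI3 p-prime p%4≡1 r (t²+1≈0⇒t⁴≈1 r r²+1≈0) r r²+1≈0
    where r²+1≈0 = ∣⇒≈0 p∣r²+1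

  dicyclic : ¬ IsCI3 (Fin p × Fin 4) (sdOp (p ∸ 1))
  dicyclic = semidirect-¬CI3 (p ∸ 1) (t²≈1⇒t⁴≈1 (p ∸ 1) [m∸1]²≈1)
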